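{- Let $r$ be a positive integer and set $\varepsilon=(-1)^{r+1}$. (1) Let $v$ be an integer with $2^rv^2\equiv-\varepsilon\pmod3$ and set $x=\frac{2^rv^2+\varepsilon}{3}$. Then the discriminant module of the even nondegenerate lattice with Gram matrix $\begin{pmatrix}2^{r+1}&2^r&0&0\\2^r&2^{r+1}&2^rv&0\\0&2^rv&2x&1\\0&0&1&\varepsilon\cdot2\end{pmatrix}$ is isometrically isomorphic to $\underline{B}_{2^r}$, and no even nondegenerate lattice of smaller rank has discriminant module isometrically isomorphic to $\underline{B}_{2^r}$. (2) The discriminant module of the even nondegenerate lattice with Gram matrix $\begin{pmatrix}0&2^r\\2^r&0\end{pmatrix}$ is isometrically isomorphic to $\underline{C}_{2^r}$, and no even nondegenerate lattice of smaller rank has discriminant module isometrically isomorphic to $\underline{C}_{2^r}$.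
   Context: A lattice $(L,B)$ is a free $\mathbb{Z}$-module $L$ of finite rank with a symmetric bilinear form $B\colon L\times L\to\mathbb{R}$; nondegenerate means its Gram matrix with respect to a basis has nonzero determinant; even means $B(x,y)\in\mathbb{Z}$ and $B(x,x)\in2\mathbb{Z}$ for all $x,y$. The lattice with Gram matrix $G$ is $\mathbb{Z}^n$ with $B(x,y)=x^{\mathrm T}Gy$. Dual lattice $L^\sharp=\{v\in\mathbb{R}\otimes L: B(v,w)\in\mathbb{Z}\ \forall w\in L\}$; discriminant module of an even nondegenerate lattice: $D_L=(L^\sharp/L,\ v+L\mapsto\frac12B(v,v)+\mathbb{Z})$. Finite quadratic modules are finite abelian groups with $Q\colon M\to\mathbb{Q}/\mathbb{Z}$, $Q(nx)=n^2Q(x)$, with $Q(x+y)-Q(x)-Q(y)$ bilinear nondegenerate; isometric isomorphisms are group isomorphisms preserving $Q$. $\underline{B}_{2^r}=((\mathbb{Z}/2^r\mathbb{Z})^2,\ (x,y)\mapsto\frac{x^2+xy+y^2}{2^r}+\mathbb{Z})$, $\underline{C}_{2^r}=((\mathbb{Z}/2^r\mathbb{Z})^2,\ (x,y)\mapsto\frac{xy}{2^r}+\mathbb{Z})$. -}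

module Defs where

open import Data.Nat as ℕ using (ℕ; zero; suc; NonZero)
open import Data.Nat.Properties using (m^n≢0)
open import Data.Fin using (Fin; zero; suc; punchIn)
open import Data.Integer as ℤ using (ℤ; +_; -[1+_])
open import Data.Integer.Divisibility using (_∣_)
open import Data.Rational as ℚ using (ℚ; ½)
open import Data.Product using (Σ; ∃; _×_; _,_)
open import Relation.Binary.PropositionalEquality using (_≡_; _≢_)
open import Relation.Nullary using (¬_)

Mat : ℕ → Set
Mat n = Fin n → Fin n → ℤ

ℤVec : ℕ → Set
ℤVec n = Fin n → ℤ

ℚVec : ℕ → Set
ℚVec n = Fin n → ℚ

sumℤ : ∀ {n} → (Fin n → ℤ) → ℤ
sumℤ {zero}  f = + 0
sumℤ {suc n} f = f zero ℤ.+ sumℤ (λ i → f (suc i))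

sumℚ : ∀ {n} → (Fin n → ℚ) → ℚ
sumℚ {zero}  f = ℚ.0ℚ
sumℚ {suc n} f = f zero ℚ.+ sumℚ (λ i → f (suc i))

det : ∀ {n} → Mat n → ℤ
det {zero}  M = + 1
det {suc n} M =
  sumℤ (λ j → (ℤ.- (+ 1)) ℤ.^ Data.Fin.toℕ j ℤ.* M zero j
              ℤ.* det (λ a b → M (suc a) (punchIn j b)))

ι : ℤ → ℚ
ι z = z ℚ./ 1

IsIntegral : ℚ → Set
IsIntegral q = Σ ℤ λ z → q ≡ ι z

-- The lattice (ℤⁿ, B) with B(x,y) = xᵀ G y, extended to ℚⁿ

Bℤ : ∀ {n} → Mat n → ℤVec n → ℤVec n → ℤ
Bℤ G x y = sumℤ (λ i → sumℤ (λ j → x i ℤ.* G i j ℤ.* y j))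

Bℚ : ∀ {n} → Mat n → ℚVec n → ℚVec n → ℚ
Bℚ G v w = sumℚ (λ i → sumℚ (λ j → v i ℚ.* ι (G i j) ℚ.* w j))

IsSymmetric : ∀ {n} → Mat n → Set
IsSymmetric G = ∀ i j → G i j ≡ G j i

-- even: B(x,y) ∈ ℤ (automatic, G has integer entries) and B(x,x) ∈ 2ℤ
IsEven : ∀ {n} → Mat n → Set
IsEven G = ∀ x → (+ 2) ∣ Bℤ G x x

IsNondegenerate : ∀ {n} → Mat n → Set
IsNondegenerate G = det G ≢ + 0

IsEvenNondegLattice : ∀ {n} → Mat n → Set
IsEvenNondegLattice G = IsSymmetric G × IsEven G × IsNondegenerate G

InDual : ∀ {n} → Mat n → ℚVec n → Set
InDual {n} G v = ∀ (w : ℤVec n) → IsIntegral (Bℚ G v (λ i → ι (w i)))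

InL : ∀ {n} → ℚVec n → Set
InL v = ∀ i → IsIntegral (v i)

_-ᵥ_ : ∀ {n} → ℚVec n → ℚVec n → ℚVec n
(v -ᵥ w) i = v i ℚ.- w i

_+ᵥ_ : ∀ {n} → ℚVec n → ℚVec n → ℚVec n
(v +ᵥ w) i = v i ℚ.+ w i

-- quadratic form of the discriminant module, as a rational representative
qDisc : ∀ {n} → Mat n → ℚVec n → ℚ
qDisc G v = ½ ℚ.* Bℚ G v v

-- Finite quadratic modules on (ℤ/Nℤ)², presented via representatives in ℤ²,
-- with quadratic form given by a rational-valued function q (read mod ℤ).

_≡[mod_]_ : ℤ → ℕ → ℤ → Set
a ≡[mod N ] b = (+ N) ∣ (a ℤ.- b)

record DiscIso {n : ℕ} (N : ℕ) (q : ℤ → ℤ → ℚ) (G : Mat n) : Set where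
  field
    φ       : ℤ → ℤ → ℚVec n
    dual    : ∀ a b → InDual G (φ a b)
    wd-inj  : ∀ a b a' b' →
              ((a ≡[mod N ] a') × (b ≡[mod N ] b')) → InL (φ a b -ᵥ φ a' b')
    inj     : ∀ a b a' b' →
              InL (φ a b -ᵥ φ a' b') → (a ≡[mod N ] a') × (b ≡[mod N ] b')
    hom     : ∀ a b a' b' →
              InL (φ (a ℤ.+ a') (b ℤ.+ b') -ᵥ (φ a b +ᵥ φ a' b'))
    surj    : ∀ v → InDual G v → Σ ℤ λ a → Σ ℤ λ b → InL (v -ᵥ φ a b)
    isometry : ∀ a b → IsIntegral (qDisc G (φ a b) ℚ.- q a b)

pow2 : ℕ → ℕ
pow2 r = 2 ℕ.^ r

pow2-nonZero : ∀ r → NonZero (pow2 r)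
pow2-nonZero r = m^n≢0 2 r

qB : ℕ → ℤ → ℤ → ℚ
qB r x y = ((x ℤ.* x ℤ.+ x ℤ.* y ℤ.+ y ℤ.* y) ℚ./ pow2 r) {{pow2-nonZero r}}

qC : ℕ → ℤ → ℤ → ℚ
qC r x y = ((x ℤ.* y) ℚ./ pow2 r) {{pow2-nonZero r}}

DiscIsoB : ℕ → ∀ {n} → Mat n → Set
DiscIsoB r G = DiscIso (pow2 r) (qB r) G

DiscIsoC : ℕ → ∀ {n} → Mat n → Set
DiscIsoC r G = DiscIso (pow2 r) (qC r) G

ε : ℕ → ℤ
ε r = (ℤ.- (+ 1)) ℤ.^ (suc r)

GramB : ℕ → ℤ → ℤ → Mat 4
GramB r v x = λ i j → entry i j
  where
  t : ℤ
  t = + pow2 r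
  entry : Fin 4 → Fin 4 → ℤ
  entry zero zero = (+ 2) ℤ.* t
  entry zero (suc zero) = t
  entry (suc zero) zero = t
  entry (suc zero) (suc zero) = (+ 2) ℤ.* t
  entry (suc zero) (suc (suc zero)) = t ℤ.* v
  entry (suc (suc zero)) (suc zero) = t ℤ.* v
  entry (suc (suc zero)) (suc (suc zero)) = (+ 2) ℤ.* x
  entry (suc (suc zero)) (suc (suc (suc zero))) = + 1
  entry (suc (suc (suc zero))) (suc (suc zero)) = + 1
  entry (suc (suc (suc zero))) (suc (suc (suc zero))) = ε r ℤ.* (+ 2)
  entry _ _ = + 0

GramC : ℕ → Mat 2
GramC r zero (suc zero) = + pow2 r
GramC r (suc zero) zero = + pow2 r
GramC r _ _ = + 0

-- Write N = 2^r = 2h. An isometry (ℤ/Nℤ)² ≅ D_L is determined by the images φ₁, φ₂ of the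
-- generators; w₁ = Nφ₁, w₂ = Nφ₂ are integer vectors with G·wᵢ ≡ 0 (mod N), and since the images of
-- (1,0), (0,1), (1,1) have order exactly N, the vectors w₁, w₂, w₁ + w₂ are nonzero modulo 2.
-- In rank ≤ 1 this is impossible. In rank 3, G mod 2 is an alternating 3 × 3 matrix over 𝔽₂
-- whose kernel contains w₁ and w₂, so G ≡ 0 (mod 2); then ½ℤ³ ⊆ L♯ and 𝔽₂³ would be spanned by
-- w₁, w₂. In rank 2, det(w₁, w₂) is odd, so G = N·U with U integral, and U is unimodular since
-- D_L has exponent N; the values 1, 1, 3 of q_B make the Gram determinant of w₁, w₂ with
-- respect to U congruent to 3 mod 8, while it equals det(w₁, w₂)² · det U ≡ ±1 (mod 8).
-- Only the last argument uses q_B, which is why C_{2^r} is realised in rank 2.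
--
-- The realisations send the generators to 2^{-r} times two coordinate vectors. For B_{2^r},
-- surjectivity rests on the Gram matrix with its first two rows divided by 2^r being unimodular,
-- which is where 3x = 2^r v² + ε and ε² = 1 enter.

module Submission where

open import Defs
open import Data.Nat using (ℕ; _≤_)
open import Data.Integer using (ℤ; +_; _+_; _*_; -_)
open import Data.Integer.Divisibility using (_∣_)
open import Data.Product using (_×_)
open import Relation.Binary.PropositionalEquality using (_≡_)

open import Data.Nat as ℕ using (zero; suc; NonZero; z≤n; s≤s)
import Data.Nat.Properties as ℕP
import Data.Nat.Divisibility as ℕD
open import Data.Integer as ℤ using (-[1+_])
import Data.Integer.Properties as ℤP
import Data.Integer.DivMod as ℤ
import Data.Integer.Divisibility.Signed as S
open import Data.Integer.Tactic.RingSolver using () renaming (solve-∀ to ℤ-solve)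
open import Data.Integer.Solver using (module +-*-Solver)
open +-*-Solver using (Polynomial; con; var; _:+_; _:*_; :-_; _:-_; prove)
import Data.Rational.Solver as ℚSolver
open ℚSolver.+-*-Solver using () renaming (Polynomial to ℚPolynomial; prove to ℚ-prove; ⟦_⟧ to ℚ⟦_⟧; ⟦_⟧↓ to ℚ⟦_⟧↓)
open import Data.Rational as ℚ using (ℚ; ½)
import Data.Rational.Properties as ℚP
import Data.Rational.Unnormalised as ℚᵘ
import Data.Rational.Unnormalised.Properties as ℚᵘP
open import Data.Fin using (Fin; zero; suc; toℕ; punchIn; #_; _↑ˡ_)
open import Data.Vec using (Vec; []; _∷_)
open import Data.Bool using (Bool; true; false; not; _∧_; _∨_; _xor_)
import Data.Bool.Properties as BoolP
open import Data.Product using (Σ; _,_; proj₁; proj₂)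
open import Data.Sum using (_⊎_; inj₁; inj₂; [_,_]′)
open import Data.Empty using (⊥; ⊥-elim)
open import Data.Unit using (tt)
open import Data.Maybe using (Maybe; just; nothing)
open import Level using (0ℓ)
open import Relation.Nullary using (¬_; yes; no)
open import Relation.Nullary.Decidable using (toWitnessFalse)
open import Relation.Binary.PropositionalEquality
  using (_≢_; refl; sym; trans; cong; cong₂; subst; subst₂; module ≡-Reasoning)
open import Tactic.RingSolver using () renaming (solve-∀ to solve-∀-in)
open import Tactic.RingSolver.Core.AlmostCommutativeRing using (AlmostCommutativeRing; fromCommutativeRing)

ℚ-ring : AlmostCommutativeRing 0ℓ 0ℓ
ℚ-ring = fromCommutativeRing ℚP.+-*-commutativeRing isZero
  where
  isZero : (x : ℚ) → Maybe (ℚ.0ℚ ≡ x)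
  isZero x with x ℚP.≟ ℚ.0ℚ
  ... | yes x≡0 = just (sym x≡0)
  ... | no _    = nothing

ι-toℚᵘ : ∀ z → ℚ.toℚᵘ (ι z) ℚᵘ.≃ ℚᵘ.mkℚᵘ z 0
ι-toℚᵘ z = ℚP.toℚᵘ-fromℚᵘ (ℚᵘ.mkℚᵘ z 0)

ι-+ : ∀ a b → ι (a ℤ.+ b) ≡ ι a ℚ.+ ι b
ι-+ a b = ℚP.toℚᵘ-injective (ℚᵘP.≃-trans (ι-toℚᵘ (a ℤ.+ b))
  (ℚᵘP.≃-trans (ℚᵘ.*≡* (normalised a b)) (ℚᵘP.≃-sym (ℚᵘP.≃-trans (ℚP.toℚᵘ-homo-+ (ι a) (ι b))
    (ℚᵘP.+-cong (ι-toℚᵘ a) (ι-toℚᵘ b))))))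
  where
  normalised : ∀ a b → (a ℤ.+ b) ℤ.* + 1 ≡ (a ℤ.* + 1 ℤ.+ b ℤ.* + 1) ℤ.* + 1
  normalised = ℤ-solve

ι-* : ∀ a b → ι (a ℤ.* b) ≡ ι a ℚ.* ι b
ι-* a b = ℚP.toℚᵘ-injective (ℚᵘP.≃-trans (ι-toℚᵘ (a ℤ.* b))
  (ℚᵘP.≃-sym (ℚᵘP.≃-trans (ℚP.toℚᵘ-homo-* (ι a) (ι b)) (ℚᵘP.*-cong (ι-toℚᵘ a) (ι-toℚᵘ b)))))

ι-neg : ∀ a → ι (ℤ.- a) ≡ ℚ.- ι a
ι-neg a = ℚP.toℚᵘ-injective (ℚᵘP.≃-trans (ι-toℚᵘ (ℤ.- a))
  (ℚᵘP.≃-sym (ℚᵘP.≃-trans (ℚP.toℚᵘ-homo‿- (ι a)) (ℚᵘP.-‿cong (ι-toℚᵘ a)))))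

ι-- : ∀ a b → ι (a ℤ.- b) ≡ ι a ℚ.- ι b
ι-- a b = trans (ι-+ a (ℤ.- b)) (cong (ι a ℚ.+_) (ι-neg b))

ι-injective : ∀ {a b} → ι a ≡ ι b → a ≡ b
ι-injective {a} {b} eq
  with ℚᵘP.≃-trans (ℚᵘP.≃-sym (ι-toℚᵘ a)) (ℚᵘP.≃-trans (ℚᵘP.≃-reflexive (cong ℚ.toℚᵘ eq)) (ι-toℚᵘ b))
... | ℚᵘ.*≡* e = trans (sym (ℤP.*-identityʳ a)) (trans e (ℤP.*-identityʳ b))

inv : (N : ℕ) → .{{NonZero N}} → ℚ
inv N = + 1 ℚ./ N

ι*inv : ∀ N .{{_ : NonZero N}} → ι (+ N) ℚ.* inv N ≡ ℚ.1ℚ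
ι*inv (suc m) = ℚP.toℚᵘ-injective (ℚᵘP.≃-trans (ℚP.toℚᵘ-homo-* (ι (+ suc m)) (inv (suc m)))
  (ℚᵘP.≃-trans (ℚᵘP.*-cong (ι-toℚᵘ (+ suc m)) (ℚP.toℚᵘ-fromℚᵘ (ℚᵘ.mkℚᵘ (+ 1) m))) (ℚᵘ.*≡* e)))
  where
  e : ℚᵘ.↥ (ℚᵘ.mkℚᵘ (+ suc m) 0 ℚᵘ.* ℚᵘ.mkℚᵘ (+ 1) m) ℤ.* ℚᵘ.↧ ℚ.toℚᵘ ℚ.1ℚ
      ≡ ℚᵘ.↥ ℚ.toℚᵘ ℚ.1ℚ ℤ.* ℚᵘ.↧ (ℚᵘ.mkℚᵘ (+ suc m) 0 ℚᵘ.* ℚᵘ.mkℚᵘ (+ 1) m)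
  e = trans (ℤP.*-identityʳ _) (trans (ℤP.*-identityʳ _)
        (trans (cong +_ (sym (ℕP.*-identityˡ (suc m)))) (sym (ℤP.*-identityˡ _))))

inv*ι : ∀ N .{{_ : NonZero N}} → inv N ℚ.* ι (+ N) ≡ ℚ.1ℚ
inv*ι N = trans (ℚP.*-comm (inv N) (ι (+ N))) (ι*inv N)

ι*-cancelˡ : ∀ m .{{_ : NonZero m}} {x y} → ι (+ m) ℚ.* x ≡ ι (+ m) ℚ.* y → x ≡ y
ι*-cancelˡ m {x} {y} e = trans (sym (undo x)) (trans (cong (inv m ℚ.*_) e) (undo y))
  where
  undo : ∀ z → inv m ℚ.* (ι (+ m) ℚ.* z) ≡ z
  undo z = trans (sym (ℚP.*-assoc (inv m) (ι (+ m)) z))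
                 (trans (cong (ℚ._* z) (inv*ι m)) (ℚP.*-identityˡ z))

/≡ι*inv : ∀ z N .{{_ : NonZero N}} → z ℚ./ N ≡ ι z ℚ.* inv N
/≡ι*inv z (suc m) = ℚP.toℚᵘ-injective (ℚᵘP.≃-trans (ℚP.toℚᵘ-fromℚᵘ (ℚᵘ.mkℚᵘ z m))
  (ℚᵘP.≃-sym (ℚᵘP.≃-trans (ℚP.toℚᵘ-homo-* (ι z) (inv (suc m)))
  (ℚᵘP.≃-trans (ℚᵘP.*-cong (ι-toℚᵘ z) (ℚP.toℚᵘ-fromℚᵘ (ℚᵘ.mkℚᵘ (+ 1) m))) (ℚᵘ.*≡* e)))))
  where
  e : ℚᵘ.↥ (ℚᵘ.mkℚᵘ z 0 ℚᵘ.* ℚᵘ.mkℚᵘ (+ 1) m) ℤ.* ℚᵘ.↧ (ℚᵘ.mkℚᵘ z m)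
      ≡ ℚᵘ.↥ (ℚᵘ.mkℚᵘ z m) ℤ.* ℚᵘ.↧ (ℚᵘ.mkℚᵘ z 0 ℚᵘ.* ℚᵘ.mkℚᵘ (+ 1) m)
  e = sym (trans (cong (z ℤ.*_) (cong +_ (ℕP.*-identityˡ (suc m))))
        (cong (ℤ._* (+ suc m)) (sym (ℤP.*-identityʳ z))))

integral-ι : ∀ z → IsIntegral (ι z)
integral-ι z = z , refl

integral-0 : IsIntegral ℚ.0ℚ
integral-0 = integral-ι (+ 0)

integral-+ : ∀ {p q} → IsIntegral p → IsIntegral q → IsIntegral (p ℚ.+ q)
integral-+ (a , refl) (b , refl) = a ℤ.+ b , sym (ι-+ a b)

integral-neg : ∀ {p} → IsIntegral p → IsIntegral (ℚ.- p)
integral-neg (a , refl) = ℤ.- a , sym (ι-neg a)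

integral-- : ∀ {p q} → IsIntegral p → IsIntegral q → IsIntegral (p ℚ.- q)
integral-- ip iq = integral-+ ip (integral-neg iq)

integral-* : ∀ {p q} → IsIntegral p → IsIntegral q → IsIntegral (p ℚ.* q)
integral-* (a , refl) (b , refl) = a ℤ.* b , sym (ι-* a b)

integral⇒∣ : ∀ X N .{{_ : NonZero N}} → IsIntegral (ι X ℚ.* inv N) → + N S.∣ X
integral⇒∣ X N (k , eq) = S.divides k (ι-injective (begin
  ι X                          ≡⟨ ℚP.*-identityʳ (ι X) ⟨
  ι X ℚ.* ℚ.1ℚ                 ≡⟨ cong (ι X ℚ.*_) (inv*ι N) ⟨
  ι X ℚ.* (inv N ℚ.* ι (+ N))  ≡⟨ ℚP.*-assoc (ι X) (inv N) (ι (+ N)) ⟨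
  ι X ℚ.* inv N ℚ.* ι (+ N)    ≡⟨ cong (ℚ._* ι (+ N)) eq ⟩
  ι k ℚ.* ι (+ N)              ≡⟨ ι-* k (+ N) ⟨
  ι (k ℤ.* + N)                ∎))
  where open ≡-Reasoning

∣⇒integral : ∀ X N .{{_ : NonZero N}} → + N S.∣ X → IsIntegral (ι X ℚ.* inv N)
∣⇒integral X N (S.divides k refl) = k , (begin
  ι (k ℤ.* + N) ℚ.* inv N        ≡⟨ cong (ℚ._* inv N) (ι-* k (+ N)) ⟩
  ι k ℚ.* ι (+ N) ℚ.* inv N      ≡⟨ ℚP.*-assoc (ι k) (ι (+ N)) (inv N) ⟩
  ι k ℚ.* (ι (+ N) ℚ.* inv N)    ≡⟨ cong (ι k ℚ.*_) (ι*inv N) ⟩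
  ι k ℚ.* ℚ.1ℚ                   ≡⟨ ℚP.*-identityʳ (ι k) ⟩
  ι k                            ∎)
  where open ≡-Reasoning

ιᵛ : ∀ {n} → ℤVec n → ℚVec n
ιᵛ w i = ι (w i)

infixl 7 _·ᵛ_
_·ᵛ_ : ∀ {n} → ℚ → ℚVec n → ℚVec n
(c ·ᵛ v) i = c ℚ.* v i

0ᵛ : ∀ {n} → ℚVec n
0ᵛ _ = ℚ.0ℚ

infix 4 _∼_
record _∼_ {n} (v w : ℚVec n) : Set where
  constructor mk∼
  field un∼ : InL (v -ᵥ w)
open _∼_ public

InL-ιᵛ : ∀ {n} (w : ℤVec n) → InL (ιᵛ w)
InL-ιᵛ w i = integral-ι (w i)

∼-reflexive : ∀ {n} {v w : ℚVec n} → (∀ i → v i ≡ w i) → v ∼ w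
∼-reflexive {w = w} e = mk∼ λ i →
  subst IsIntegral (trans (sym (ℚP.+-inverseʳ (w i))) (cong (ℚ._- w i) (sym (e i)))) integral-0

∼-refl : ∀ {n} (v : ℚVec n) → v ∼ v
∼-refl v = ∼-reflexive (λ _ → refl)

∼-sym : ∀ {n} {v w : ℚVec n} → v ∼ w → w ∼ v
∼-sym {v = v} {w} (mk∼ p) = mk∼ λ i → subst IsIntegral (lem (v i) (w i)) (integral-neg (p i))
  where
  lem : ∀ a b → ℚ.- (a ℚ.- b) ≡ b ℚ.- a
  lem = solve-∀-in ℚ-ring

∼-trans : ∀ {n} {u v w : ℚVec n} → u ∼ v → v ∼ w → u ∼ w
∼-trans {u = u} {v} {w} (mk∼ p) (mk∼ q) = mk∼ λ i →
  subst IsIntegral (lem (u i) (v i) (w i)) (integral-+ (p i) (q i))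
  where
  lem : ∀ a b c → (a ℚ.- b) ℚ.+ (b ℚ.- c) ≡ a ℚ.- c
  lem = solve-∀-in ℚ-ring

∼-+ : ∀ {n} {v v' w w' : ℚVec n} → v ∼ w → v' ∼ w' → (v +ᵥ v') ∼ (w +ᵥ w')
∼-+ {v = v} {v'} {w} {w'} (mk∼ p) (mk∼ q) = mk∼ λ i →
  subst IsIntegral (lem (v i) (v' i) (w i) (w' i)) (integral-+ (p i) (q i))
  where
  lem : ∀ a b c d → (a ℚ.- c) ℚ.+ (b ℚ.- d) ≡ (a ℚ.+ b) ℚ.- (c ℚ.+ d)
  lem = solve-∀-in ℚ-ring

∼-·ᵛ : ∀ {n} {v w : ℚVec n} (k : ℤ) → v ∼ w → ι k ·ᵛ v ∼ ι k ·ᵛ w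
∼-·ᵛ {v = v} {w} k (mk∼ p) = mk∼ λ i →
  subst IsIntegral (lem (ι k) (v i) (w i)) (integral-* (integral-ι k) (p i))
  where
  lem : ∀ c a b → c ℚ.* (a ℚ.- b) ≡ c ℚ.* a ℚ.- c ℚ.* b
  lem = solve-∀-in ℚ-ring

InL⇒∼0 : ∀ {n} {v : ℚVec n} → InL v → v ∼ 0ᵛ
InL⇒∼0 {v = v} p = mk∼ λ i → subst IsIntegral (sym (ℚP.+-identityʳ (v i))) (p i)

∼0⇒InL : ∀ {n} {v : ℚVec n} → v ∼ 0ᵛ → InL v
∼0⇒InL {v = v} (mk∼ p) i = subst IsIntegral (ℚP.+-identityʳ (v i)) (p i)

InL-resp-∼ : ∀ {n} {v w : ℚVec n} → v ∼ w → InL w → InL v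
InL-resp-∼ v∼w w∈L = ∼0⇒InL (∼-trans v∼w (InL⇒∼0 w∈L))

sumℚ-cong : ∀ {n} {f g : Fin n → ℚ} → (∀ i → f i ≡ g i) → sumℚ f ≡ sumℚ g
sumℚ-cong {zero}  e = refl
sumℚ-cong {suc n} e = cong₂ ℚ._+_ (e zero) (sumℚ-cong (λ i → e (suc i)))

sumℚ-ι : ∀ {n} (f : Fin n → ℤ) → sumℚ (λ i → ι (f i)) ≡ ι (sumℤ f)
sumℚ-ι {zero}  f = refl
sumℚ-ι {suc n} f = trans (cong (ι (f zero) ℚ.+_) (sumℚ-ι (λ i → f (suc i))))
                         (sym (ι-+ (f zero) (sumℤ (λ i → f (suc i)))))

sumℚ-*ˡ : ∀ {n} (c : ℚ) (f : Fin n → ℚ) → sumℚ (λ i → c ℚ.* f i) ≡ c ℚ.* sumℚ f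
sumℚ-*ˡ {zero}  c f = sym (ℚP.*-zeroʳ c)
sumℚ-*ˡ {suc n} c f = trans (cong (c ℚ.* f zero ℚ.+_) (sumℚ-*ˡ c (λ i → f (suc i))))
                            (sym (ℚP.*-distribˡ-+ c _ _))

Bℚ-cong : ∀ {n} (G : Mat n) {v v' w w' : ℚVec n} →
          (∀ i → v i ≡ v' i) → (∀ i → w i ≡ w' i) → Bℚ G v w ≡ Bℚ G v' w'
Bℚ-cong G ev ew = sumℚ-cong λ i → sumℚ-cong λ j →
  cong₂ (λ a b → a ℚ.* ι (G i j) ℚ.* b) (ev i) (ew j)

Bℚ-ι : ∀ {n} (G : Mat n) (u w : ℤVec n) → Bℚ G (ιᵛ u) (ιᵛ w) ≡ ι (Bℤ G u w)
Bℚ-ι {n} G u w = trans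
  (sumℚ-cong λ i → trans
    (sumℚ-cong λ j → trans (cong (ℚ._* ι (w j)) (sym (ι-* (u i) (G i j)))) (sym (ι-* (u i ℤ.* G i j) (w j))))
    (sumℚ-ι {n} (λ j → u i ℤ.* G i j ℤ.* w j)))
  (sumℚ-ι {n} (λ i → sumℤ (λ j → u i ℤ.* G i j ℤ.* w j)))

Bℚ-*ˡ : ∀ {n} (G : Mat n) (c : ℚ) (v w : ℚVec n) → Bℚ G (c ·ᵛ v) w ≡ c ℚ.* Bℚ G v w
Bℚ-*ˡ {n} G c v w = trans
  (sumℚ-cong λ i → trans (sumℚ-cong λ j → lem c (v i) (ι (G i j)) (w j))
                         (sumℚ-*ˡ {n} c (λ j → v i ℚ.* ι (G i j) ℚ.* w j)))
  (sumℚ-*ˡ {n} c (λ i → sumℚ (λ j → v i ℚ.* ι (G i j) ℚ.* w j)))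
  where
  lem : ∀ c a g b → c ℚ.* a ℚ.* g ℚ.* b ≡ c ℚ.* (a ℚ.* g ℚ.* b)
  lem = solve-∀-in ℚ-ring

Bℚ-*ʳ : ∀ {n} (G : Mat n) (c : ℚ) (v w : ℚVec n) → Bℚ G v (c ·ᵛ w) ≡ c ℚ.* Bℚ G v w
Bℚ-*ʳ {n} G c v w = trans
  (sumℚ-cong λ i → trans (sumℚ-cong λ j → lem c (v i) (ι (G i j)) (w j))
                         (sumℚ-*ˡ {n} c (λ j → v i ℚ.* ι (G i j) ℚ.* w j)))
  (sumℚ-*ˡ {n} c (λ i → sumℚ (λ j → v i ℚ.* ι (G i j) ℚ.* w j)))
  where
  lem : ∀ c a g b → a ℚ.* g ℚ.* (c ℚ.* b) ≡ c ℚ.* (a ℚ.* g ℚ.* b)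
  lem = solve-∀-in ℚ-ring

sumℚ-0 : ∀ {n} → sumℚ {n} (λ _ → ℚ.0ℚ) ≡ ℚ.0ℚ
sumℚ-0 {zero}  = refl
sumℚ-0 {suc n} = trans (ℚP.+-identityˡ _) (sumℚ-0 {n})

basis : ∀ {n} → Fin n → ℤVec n
basis zero    zero    = + 1
basis zero    (suc _) = + 0
basis (suc _) zero    = + 0
basis (suc i) (suc j) = basis i j

sumℚ-*basis : ∀ {n} (f : Fin n → ℚ) j → sumℚ (λ k → f k ℚ.* ι (basis j k)) ≡ f j
sumℚ-*basis {suc n} f zero = begin
  f zero ℚ.* ℚ.1ℚ ℚ.+ sumℚ (λ k → f (suc k) ℚ.* ℚ.0ℚ)
    ≡⟨ cong₂ ℚ._+_ (ℚP.*-identityʳ (f zero)) (trans (sumℚ-cong λ k → ℚP.*-zeroʳ (f (suc k))) (sumℚ-0 {n})) ⟩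
  f zero ℚ.+ ℚ.0ℚ
    ≡⟨ ℚP.+-identityʳ (f zero) ⟩
  f zero ∎
  where open ≡-Reasoning
sumℚ-*basis {suc n} f (suc j) =
  trans (cong (ℚ._+ rest) (ℚP.*-zeroʳ (f zero)))
        (trans (ℚP.+-identityˡ rest) (sumℚ-*basis (λ k → f (suc k)) j))
  where
  rest = sumℚ (λ k → f (suc k) ℚ.* ι (basis j k))

sumℚ-basis* : ∀ {n} (f : Fin n → ℚ) i → sumℚ (λ k → ι (basis i k) ℚ.* f k) ≡ f i
sumℚ-basis* f i = trans (sumℚ-cong λ k → ℚP.*-comm (ι (basis i k)) (f k)) (sumℚ-*basis f i)

Bℚ-basisʳ : ∀ {n} (G : Mat n) (v : ℚVec n) j → Bℚ G v (ιᵛ (basis j)) ≡ sumℚ (λ i → v i ℚ.* ι (G i j))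
Bℚ-basisʳ G v j = sumℚ-cong λ i → sumℚ-*basis (λ k → v i ℚ.* ι (G i k)) j

Bℤ-basisʳ : ∀ {n} (G : Mat n) (w : ℤVec n) j → Bℤ G w (basis j) ≡ sumℤ (λ i → w i ℤ.* G i j)
Bℤ-basisʳ {n} G w j = ι-injective (begin
  ι (Bℤ G w (basis j))                       ≡⟨ Bℚ-ι G w (basis j) ⟨
  Bℚ G (ιᵛ w) (ιᵛ (basis j))                 ≡⟨ Bℚ-basisʳ G (ιᵛ w) j ⟩
  sumℚ (λ i → ι (w i) ℚ.* ι (G i j))         ≡⟨ sumℚ-cong (λ i → ι-* (w i) (G i j)) ⟨
  sumℚ (λ i → ι (w i ℤ.* G i j))             ≡⟨ sumℚ-ι {n} (λ i → w i ℤ.* G i j) ⟩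
  ι (sumℤ (λ i → w i ℤ.* G i j))             ∎)
  where open ≡-Reasoning

Bℤ-basis : ∀ {n} (G : Mat n) i j → Bℤ G (basis i) (basis j) ≡ G i j
Bℤ-basis {n} G i j = ι-injective (begin
  ι (Bℤ G (basis i) (basis j))                      ≡⟨ cong ι (Bℤ-basisʳ G (basis i) j) ⟩
  ι (sumℤ (λ k → basis i k ℤ.* G k j))              ≡⟨ sumℚ-ι {n} (λ k → basis i k ℤ.* G k j) ⟨
  sumℚ (λ k → ι (basis i k ℤ.* G k j))              ≡⟨ sumℚ-cong (λ k → ι-* (basis i k) (G k j)) ⟩
  sumℚ (λ k → ι (basis i k) ℚ.* ι (G k j))          ≡⟨ sumℚ-basis* (λ k → ι (G k j)) i ⟩
  ι (G i j)                                         ∎)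
  where open ≡-Reasoning

-- sumᴾ, detᴾ and Bᴾ repeat the definitions of sumℤ, det and Bℤ on polynomial
-- syntax, so that evaluating them is definitionally sumℤ, det and Bℤ of the
-- evaluated matrix; this lets `prove` decide identities about concrete
-- determinants and Gram forms.
sumᴾ : ∀ {m n} → (Fin n → Polynomial m) → Polynomial m
sumᴾ {n = zero}  f = con (+ 0)
sumᴾ {n = suc n} f = f zero :+ sumᴾ (λ i → f (suc i))

detᴾ : ∀ {m n} → (Fin n → Fin n → Polynomial m) → Polynomial m
detᴾ {n = zero}  M = con (+ 1)
detᴾ {n = suc n} M =
  sumᴾ (λ j → con ((ℤ.- (+ 1)) ℤ.^ toℕ j) :* M zero j :* detᴾ (λ a b → M (suc a) (punchIn j b)))

Bᴾ : ∀ {m n} → (Fin n → Fin n → Polynomial m) → (Fin n → Polynomial m) → (Fin n → Polynomial m) →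
     Polynomial m
Bᴾ G x y = sumᴾ (λ i → sumᴾ (λ j → x i :* G i j :* y j))

-- Isometric isomorphisms (ℤ/Nℤ)² ≅ D_L

module DiscIsoProperties {n : ℕ} (N : ℕ) {{_ : NonZero N}} {q : ℤ → ℤ → ℚ} {G : Mat n}
                         (D : DiscIso N q G) where
  open DiscIso D

  φ-cong : ∀ {a a' b b'} → a ≡ a' → b ≡ b' → φ a b ∼ φ a' b'
  φ-cong refl refl = ∼-refl _

  φ-+ : ∀ a b a' b' → φ (a ℤ.+ a') (b ℤ.+ b') ∼ φ a b +ᵥ φ a' b'
  φ-+ a b a' b' = mk∼ (hom a b a' b')

  φ-0∈L : InL (φ (+ 0) (+ 0))
  φ-0∈L i = subst IsIntegral (lem (φ (+ 0) (+ 0) i)) (integral-neg (hom (+ 0) (+ 0) (+ 0) (+ 0) i))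
    where
    lem : ∀ x → ℚ.- (x ℚ.- (x ℚ.+ x)) ≡ x
    lem = solve-∀-in ℚ-ring

  φ-·ℕ : ∀ (k : ℕ) a b → φ (+ k ℤ.* a) (+ k ℤ.* b) ∼ ι (+ k) ·ᵛ φ a b
  φ-·ℕ zero a b = ∼-trans (φ-cong (ℤP.*-zeroˡ a) (ℤP.*-zeroˡ b))
    (∼-trans (InL⇒∼0 φ-0∈L) (∼-reflexive λ i → sym (ℚP.*-zeroˡ (φ a b i))))
  φ-·ℕ (suc k) a b = ∼-trans (φ-cong (suc* a) (suc* b)) (∼-trans (φ-+ a b _ _)
    (∼-trans (∼-+ (∼-refl (φ a b)) (φ-·ℕ k a b)) (∼-reflexive λ i → lem (φ a b i))))
    where
    suc* : ∀ c → + suc k ℤ.* c ≡ c ℤ.+ + k ℤ.* c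
    suc* c = ℤP.suc-* (+ k) c
    lem : ∀ x → x ℚ.+ ι (+ k) ℚ.* x ≡ ι (+ suc k) ℚ.* x
    lem x = trans (distrib x (ι (+ k))) (cong (ℚ._* x) (sym (ι-+ (+ 1) (+ k))))
      where
      distrib : ∀ x y → x ℚ.+ y ℚ.* x ≡ (ℚ.1ℚ ℚ.+ y) ℚ.* x
      distrib = solve-∀-in ℚ-ring

  φ-· : ∀ (k : ℤ) a b → φ (k ℤ.* a) (k ℤ.* b) ∼ ι k ·ᵛ φ a b
  φ-· (+ k)      a b = φ-·ℕ k a b
  φ-· (-[1+ m ]) a b = mk∼ λ i →
    subst IsIntegral (rearrange (φₖ i) (φₖ′ i) (ι k′) (φ a b i) (sym (ι-neg k′)))
      (integral-- (un∼ sum∼0 i) (un∼ (φ-·ℕ (suc m) a b) i))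
    where
    k k′ : ℤ
    k  = -[1+ m ]
    k′ = + suc m
    φₖ φₖ′ : ℚVec n
    φₖ  = φ (k ℤ.* a) (k ℤ.* b)
    φₖ′ = φ (k′ ℤ.* a) (k′ ℤ.* b)
    cancel : ∀ c → k ℤ.* c ℤ.+ k′ ℤ.* c ≡ + 0
    cancel c = trans (sym (ℤP.*-distribʳ-+ c k k′)) (trans (cong (ℤ._* c) (ℤP.+-inverseˡ k′)) (ℤP.*-zeroˡ c))
    sum∼0 : φₖ +ᵥ φₖ′ ∼ 0ᵛ
    sum∼0 = ∼-trans (∼-sym (∼-trans (φ-cong (sym (cancel a)) (sym (cancel b))) (φ-+ _ _ _ _))) (InL⇒∼0 φ-0∈L)
    rearrange : ∀ x y c z {c′} → c′ ≡ ℚ.- c → (x ℚ.+ y ℚ.- ℚ.0ℚ) ℚ.- (y ℚ.- c ℚ.* z) ≡ x ℚ.- c′ ℚ.* z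
    rearrange x y c z refl = solve x y c z
      where
      solve : ∀ x y c z → (x ℚ.+ y ℚ.- ℚ.0ℚ) ℚ.- (y ℚ.- c ℚ.* z) ≡ x ℚ.- (ℚ.- c) ℚ.* z
      solve = solve-∀-in ℚ-ring

  φ-linear : ∀ a b → φ a b ∼ (ι a ·ᵛ φ (+ 1) (+ 0)) +ᵥ (ι b ·ᵛ φ (+ 0) (+ 1))
  φ-linear a b = ∼-trans (φ-cong (first a b) (second a b))
    (∼-trans (φ-+ (a ℤ.* + 1) (a ℤ.* + 0) (b ℤ.* + 0) (b ℤ.* + 1))
      (∼-+ (φ-· a (+ 1) (+ 0)) (φ-· b (+ 0) (+ 1))))
    where
    first : ∀ a b → a ≡ a ℤ.* + 1 ℤ.+ b ℤ.* + 0
    first = ℤ-solve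
    second : ∀ a b → b ≡ a ℤ.* + 0 ℤ.+ b ℤ.* + 1
    second = ℤ-solve

  N·φ∈L : ∀ a b → InL (ι (+ N) ·ᵛ φ a b)
  N·φ∈L a b = ∼0⇒InL (∼-trans (∼-sym (φ-·ℕ N a b))
    (∼-trans (mk∼ (wd-inj _ _ (+ 0) (+ 0) (S.∣⇒∣ᵤ (N∣N* a) , S.∣⇒∣ᵤ (N∣N* b)))) (InL⇒∼0 φ-0∈L)))
    where
    N∣N* : ∀ a → + N S.∣ (+ N ℤ.* a ℤ.- + 0)
    N∣N* a = S.divides a (trans (ℤP.+-identityʳ _) (ℤP.*-comm (+ N) a))

  N·dual∈L : ∀ v → InDual G v → InL (ι (+ N) ·ᵛ v)
  N·dual∈L v v∈L♯ with surj v v∈L♯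
  ... | a , b , v∼φ = InL-resp-∼ (∼-·ᵛ (+ N) (mk∼ v∼φ)) (N·φ∈L a b)

  φ∈L⇒∣ : ∀ a b → InL (φ a b) → + N S.∣ a × + N S.∣ b
  φ∈L⇒∣ a b φ∈L = ∣-0 a (proj₁ mod) , ∣-0 b (proj₂ mod)
    where
    mod = inj a b (+ 0) (+ 0) (un∼ (∼-trans (InL⇒∼0 φ∈L) (∼-sym (InL⇒∼0 φ-0∈L))))
    ∣-0 : ∀ c → c ≡[mod N ] (+ 0) → + N S.∣ c
    ∣-0 c d = subst (+ N S.∣_) (ℤP.+-identityʳ c) (S.∣ᵤ⇒∣ d)

-- Parity

data Bit : ℤ → Set where
  bit0 : Bit (+ 0)
  bit1 : Bit (+ 1)

Bit-odd : ∀ {b} → Bit b → Bool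
Bit-odd bit0 = false
Bit-odd bit1 = true

opaque
  odd : ℤ → Bool
  odd z with + 2 S.∣? z
  ... | yes _ = false
  ... | no _  = true

  odd-Bit : ∀ {b} (B : Bit b) → odd b ≡ Bit-odd B
  odd-Bit bit0 = refl
  odd-Bit bit1 = refl

  odd≡false⇒2∣ : ∀ {z} → odd z ≡ false → + 2 S.∣ z
  odd≡false⇒2∣ {z} e with + 2 S.∣? z
  ... | yes 2∣z = 2∣z

  2∣⇒odd≡false : ∀ {z} → + 2 S.∣ z → odd z ≡ false
  2∣⇒odd≡false {z} 2∣z with + 2 S.∣? z
  ... | yes _   = refl
  ... | no 2∤z = ⊥-elim (2∤z 2∣z)

  private
    remainder : ∀ z → Σ ℤ λ k → Σ ℤ λ b → Bit b × (z ≡ b ℤ.+ k ℤ.* + 2)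
    remainder z = z ℤ./ + 2 , + (z ℤ.% + 2) , bit (z ℤ.% + 2) (ℤ.n%d<d z (+ 2)) , ℤ.a≡a%n+[a/n]*n z (+ 2)
      where
      bit : ∀ m → m ℕ.< 2 → Bit (+ m)
      bit zero          _ = bit0
      bit (suc zero)    _ = bit1
      bit (suc (suc m)) (s≤s (s≤s ()))

    odd-+2k : ∀ x k → odd (x ℤ.+ k ℤ.* + 2) ≡ odd x
    odd-+2k x k with + 2 S.∣? (x ℤ.+ k ℤ.* + 2) | + 2 S.∣? x
    ... | yes _ | yes _ = refl
    ... | no _  | no _  = refl
    ... | yes p | no q  = ⊥-elim (q (S.∣m+n∣n⇒∣m p (S.divides k refl)))
    ... | no p  | yes q = ⊥-elim (p (S.∣m∣n⇒∣m+n q (S.divides k refl)))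

    odd-remainder : ∀ {z k b} (B : Bit b) → z ≡ b ℤ.+ k ℤ.* + 2 → odd z ≡ Bit-odd B
    odd-remainder {k = k} {b} B refl = trans (odd-+2k b k) (odd-Bit B)

  odd-+ : ∀ a b → odd (a ℤ.+ b) ≡ odd a xor odd b
  odd-+ a b with remainder a | remainder b
  ... | ka , ra , Ra , ea | kb , rb , Rb , eb = begin
    odd (a ℤ.+ b)                              ≡⟨ cong odd (trans (cong₂ ℤ._+_ ea eb) (regroup ra ka rb kb)) ⟩
    odd ((ra ℤ.+ rb) ℤ.+ (ka ℤ.+ kb) ℤ.* + 2)  ≡⟨ odd-+2k (ra ℤ.+ rb) (ka ℤ.+ kb) ⟩
    odd (ra ℤ.+ rb)                            ≡⟨ table Ra Rb ⟩
    Bit-odd Ra xor Bit-odd Rb                  ≡⟨ cong₂ _xor_ (odd-remainder {k = ka} Ra ea) (odd-remainder {k = kb} Rb eb) ⟨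
    odd a xor odd b                            ∎
    where
    open ≡-Reasoning
    regroup : ∀ ra ka rb kb → (ra ℤ.+ ka ℤ.* + 2) ℤ.+ (rb ℤ.+ kb ℤ.* + 2) ≡ (ra ℤ.+ rb) ℤ.+ (ka ℤ.+ kb) ℤ.* + 2
    regroup = ℤ-solve
    table : ∀ {x y} (X : Bit x) (Y : Bit y) → odd (x ℤ.+ y) ≡ Bit-odd X xor Bit-odd Y
    table bit0 bit0 = refl
    table bit0 bit1 = refl
    table bit1 bit0 = refl
    table bit1 bit1 = refl

  odd-* : ∀ a b → odd (a ℤ.* b) ≡ odd a ∧ odd b
  odd-* a b with remainder a | remainder b
  ... | ka , ra , Ra , ea | kb , rb , Rb , eb = begin
    odd (a ℤ.* b)                 ≡⟨ cong odd (trans (cong₂ ℤ._*_ ea eb) (regroup ra ka rb kb)) ⟩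
    odd (ra ℤ.* rb ℤ.+ k ℤ.* + 2) ≡⟨ odd-+2k (ra ℤ.* rb) k ⟩
    odd (ra ℤ.* rb)               ≡⟨ table Ra Rb ⟩
    Bit-odd Ra ∧ Bit-odd Rb       ≡⟨ cong₂ _∧_ (odd-remainder {k = ka} Ra ea) (odd-remainder {k = kb} Rb eb) ⟨
    odd a ∧ odd b                 ∎
    where
    open ≡-Reasoning
    k : ℤ
    k = ka ℤ.* rb ℤ.+ kb ℤ.* ra ℤ.+ ka ℤ.* kb ℤ.* + 2
    regroup : ∀ ra ka rb kb → (ra ℤ.+ ka ℤ.* + 2) ℤ.* (rb ℤ.+ kb ℤ.* + 2)
              ≡ ra ℤ.* rb ℤ.+ (ka ℤ.* rb ℤ.+ kb ℤ.* ra ℤ.+ ka ℤ.* kb ℤ.* + 2) ℤ.* + 2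
    regroup = ℤ-solve
    table : ∀ {x y} (X : Bit x) (Y : Bit y) → odd (x ℤ.* y) ≡ Bit-odd X ∧ Bit-odd Y
    table bit0 bit0 = refl
    table bit0 bit1 = refl
    table bit1 bit0 = refl
    table bit1 bit1 = refl

  odd-neg : ∀ a → odd (ℤ.- a) ≡ odd a
  odd-neg a = trans (cong odd (sym (ℤP.-1*i≡-i a))) (odd-* (ℤ.- + 1) a)

odd-- : ∀ a b → odd (a ℤ.- b) ≡ odd a xor odd b
odd-- a b = trans (odd-+ a (ℤ.- b)) (cong (odd a xor_) (odd-neg b))

∣-sumℤ : ∀ {n} {d} (f : Fin n → ℤ) → (∀ i → d S.∣ f i) → d S.∣ sumℤ f
∣-sumℤ {zero}  {d} f d∣f = S.divides (+ 0) (sym (ℤP.*-zeroˡ d))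
∣-sumℤ {suc n} {d} f d∣f = S.∣m∣n⇒∣m+n (d∣f zero) (∣-sumℤ {d = d} (λ i → f (suc i)) (λ i → d∣f (suc i)))

∣-Bℤ : ∀ {n} {d} (G : Mat n) (u w : ℤVec n) → (∀ i j → d S.∣ G i j) → d S.∣ Bℤ G u w
∣-Bℤ G u w d∣G = ∣-sumℤ _ λ i → ∣-sumℤ _ λ j → S.∣m⇒∣m*n (w j) (S.∣n⇒∣m*n (u i) (d∣G i j))

parity : ∀ {n} → (Fin n → Bool) → Bool
parity {zero}  f = false
parity {suc n} f = f zero xor parity (λ i → f (suc i))

parity-cong : ∀ {n} {f g : Fin n → Bool} → (∀ i → f i ≡ g i) → parity f ≡ parity g
parity-cong {zero}  e = refl
parity-cong {suc n} e = cong₂ _xor_ (e zero) (parity-cong (λ i → e (suc i)))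

odd-sumℤ : ∀ {n} (f : Fin n → ℤ) → odd (sumℤ f) ≡ parity (λ i → odd (f i))
odd-sumℤ {zero}  f = odd-Bit bit0
odd-sumℤ {suc n} f = trans (odd-+ (f zero) _) (cong (odd (f zero) xor_) (odd-sumℤ (λ i → f (suc i))))

basis-Bit : ∀ {n} (k i : Fin n) → Bit (basis k i)
basis-Bit zero    zero    = bit1
basis-Bit zero    (suc _) = bit0
basis-Bit (suc _) zero    = bit0
basis-Bit (suc k) (suc i) = basis-Bit k i

2∣-one-of : ∀ x y → + 2 S.∣ x ⊎ + 2 S.∣ y ⊎ + 2 S.∣ x ℤ.+ y
2∣-one-of x y with odd x in ox | odd y in oy
... | false | _     = inj₁ (odd≡false⇒2∣ ox)
... | true  | false = inj₂ (inj₁ (odd≡false⇒2∣ oy))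
... | true  | true  = inj₂ (inj₂ (odd≡false⇒2∣ (trans (odd-+ x y) (cong₂ _xor_ ox oy))))

allV : ∀ n → (Vec Bool n → Bool) → Bool
allV zero    f = f []
allV (suc n) f = allV n (λ v → f (true ∷ v)) ∧ allV n (λ v → f (false ∷ v))

allV-sound : ∀ n f → allV n f ≡ true → ∀ v → f v ≡ true
allV-sound zero    f e [] = e
allV-sound (suc n) f e (true ∷ v)  = allV-sound n (λ v → f (true ∷ v)) (BoolP.∧-conicalˡ _ _ e) v
allV-sound (suc n) f e (false ∷ v) = allV-sound n (λ v → f (false ∷ v)) (BoolP.∧-conicalʳ _ _ e) v

Evenᵛ : ∀ {n} → ℤVec n → Set
Evenᵛ w = ∀ i → + 2 S.∣ w i

module HalfOrder {n : ℕ} (h : ℕ) {{_ : NonZero h}} {q : ℤ → ℤ → ℚ} {G : Mat n}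
                 (D : DiscIso (2 ℕ.* h) q G) where
  N : ℕ
  N = 2 ℕ.* h

  instance
    N≢0 : NonZero N
    N≢0 = ℕP.m*n≢0 2 h

  open DiscIso D
  open DiscIsoProperties N D public

  opaque
    Nφ : ℤ → ℤ → ℤVec n
    Nφ a b i = proj₁ (N·φ∈L a b i)

    ι-Nφ : ∀ a b i → ι (+ N) ℚ.* φ a b i ≡ ι (Nφ a b i)
    ι-Nφ a b i = proj₂ (N·φ∈L a b i)

  φ≡inv*Nφ : ∀ a b i → φ a b i ≡ inv N ℚ.* ι (Nφ a b i)
  φ≡inv*Nφ a b i = ι*-cancelˡ N (trans (ι-Nφ a b i) (sym (begin
    ι (+ N) ℚ.* (inv N ℚ.* ι (Nφ a b i))   ≡⟨ ℚP.*-assoc (ι (+ N)) (inv N) _ ⟨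
    ι (+ N) ℚ.* inv N ℚ.* ι (Nφ a b i)     ≡⟨ cong (ℚ._* ι (Nφ a b i)) (ι*inv N) ⟩
    ℚ.1ℚ ℚ.* ι (Nφ a b i)                  ≡⟨ ℚP.*-identityˡ _ ⟩
    ι (Nφ a b i)                           ∎)))
    where open ≡-Reasoning

  w₁ w₂ : ℤVec n
  w₁ = Nφ (+ 1) (+ 0)
  w₂ = Nφ (+ 0) (+ 1)

  ι-N : ι (+ N) ≡ ι (+ 2) ℚ.* ι (+ h)
  ι-N = trans (cong ι (ℤP.pos-* 2 h)) (ι-* (+ 2) (+ h))

  ι-h*inv-N : ι (+ h) ℚ.* inv N ≡ ½
  ι-h*inv-N = ι*-cancelˡ 2 (trans (sym (ℚP.*-assoc (ι (+ 2)) (ι (+ h)) (inv N)))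
    (trans (cong (ℚ._* inv N) (sym ι-N)) (ι*inv N)))

  h·-InL : (v : ℚVec n) (w : ℤVec n) → (∀ i → ι (+ N) ℚ.* v i ≡ ι (w i)) → Evenᵛ w →
           InL (ι (+ h) ·ᵛ v)
  h·-InL v w Nv≡w w-even i with w-even i
  ... | S.divides k w≡k*2 = k , ι*-cancelˡ 2 (begin
    ι (+ 2) ℚ.* (ι (+ h) ℚ.* v i)   ≡⟨ ℚP.*-assoc (ι (+ 2)) (ι (+ h)) (v i) ⟨
    ι (+ 2) ℚ.* ι (+ h) ℚ.* v i     ≡⟨ cong (ℚ._* v i) ι-N ⟨
    ι (+ N) ℚ.* v i                 ≡⟨ Nv≡w i ⟩
    ι (w i)                         ≡⟨ cong ι (trans w≡k*2 (ℤP.*-comm k (+ 2))) ⟩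
    ι (+ 2 ℤ.* k)                   ≡⟨ ι-* (+ 2) k ⟩
    ι (+ 2) ℚ.* ι k                 ∎)
    where open ≡-Reasoning

  h·φ∈L⇒∣ : ∀ a b → InL (ι (+ h) ·ᵛ φ a b) → + N S.∣ + h ℤ.* a × + N S.∣ + h ℤ.* b
  h·φ∈L⇒∣ a b p = φ∈L⇒∣ (+ h ℤ.* a) (+ h ℤ.* b) (InL-resp-∼ (φ-·ℕ h a b) p)

  N∤h : ¬ (+ N S.∣ + h ℤ.* + 1)
  N∤h N∣h = ℕP.<⇒≱ (ℕP.m<m+n h (ℕ.>-nonZero⁻¹ h))
    (subst (ℕ._≤ h) (cong (h ℕ.+_) (ℕP.+-identityʳ h))
      (ℕD.∣⇒≤ {n = h} (S.∣⇒∣ᵤ (subst (+ N S.∣_) (ℤP.*-identityʳ (+ h)) N∣h))))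

  ¬even-w₁ : ¬ Evenᵛ w₁
  ¬even-w₁ even = N∤h (proj₁ (h·φ∈L⇒∣ (+ 1) (+ 0) (h·-InL _ w₁ (ι-Nφ (+ 1) (+ 0)) even)))

  ¬even-w₂ : ¬ Evenᵛ w₂
  ¬even-w₂ even = N∤h (proj₂ (h·φ∈L⇒∣ (+ 0) (+ 1) (h·-InL _ w₂ (ι-Nφ (+ 0) (+ 1)) even)))

  ¬even-w₁+w₂ : ¬ Evenᵛ (λ i → w₁ i ℤ.+ w₂ i)
  ¬even-w₁+w₂ even = N∤h (proj₁ (h·φ∈L⇒∣ (+ 1) (+ 1)
    (InL-resp-∼ (∼-·ᵛ (+ h) (φ-+ (+ 1) (+ 0) (+ 0) (+ 1)))
      (h·-InL (φ (+ 1) (+ 0) +ᵥ φ (+ 0) (+ 1)) (λ i → w₁ i ℤ.+ w₂ i) N·sum even))))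
    where
    N·sum : ∀ i → ι (+ N) ℚ.* (φ (+ 1) (+ 0) i ℚ.+ φ (+ 0) (+ 1) i) ≡ ι (w₁ i ℤ.+ w₂ i)
    N·sum i = trans (ℚP.*-distribˡ-+ (ι (+ N)) _ _)
      (trans (cong₂ ℚ._+_ (ι-Nφ (+ 1) (+ 0) i) (ι-Nφ (+ 0) (+ 1) i)) (sym (ι-+ (w₁ i) (w₂ i))))

  N∣Bℤ-Nφ : ∀ a b (y : ℤVec n) → + N S.∣ Bℤ G (Nφ a b) y
  N∣Bℤ-Nφ a b y = integral⇒∣ (Bℤ G (Nφ a b) y) N (subst IsIntegral (begin
    Bℚ G (φ a b) (ιᵛ y)                          ≡⟨ Bℚ-cong G (φ≡inv*Nφ a b) (λ _ → refl) ⟩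
    Bℚ G (inv N ·ᵛ ιᵛ (Nφ a b)) (ιᵛ y)            ≡⟨ Bℚ-*ˡ G (inv N) (ιᵛ (Nφ a b)) (ιᵛ y) ⟩
    inv N ℚ.* Bℚ G (ιᵛ (Nφ a b)) (ιᵛ y)           ≡⟨ cong (inv N ℚ.*_) (Bℚ-ι G (Nφ a b) y) ⟩
    inv N ℚ.* ι (Bℤ G (Nφ a b) y)                 ≡⟨ ℚP.*-comm (inv N) _ ⟩
    ι (Bℤ G (Nφ a b) y) ℚ.* inv N                 ∎) (dual a b y))
    where open ≡-Reasoning

  span-mod-2 : (∀ i j → + 2 S.∣ G i j) → (y : ℤVec n) →
               Σ ℤ λ α → Σ ℤ λ β → Evenᵛ (λ i → y i ℤ.- (α ℤ.* w₁ i ℤ.+ β ℤ.* w₂ i))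
  span-mod-2 G-even y = α , β , λ i → integral⇒∣ _ 2 (subst IsIntegral (component i) (un∼ v∼comb i))
    where
    v : ℚVec n
    v = ½ ·ᵛ ιᵛ y
    v∈L♯ : InDual G v
    v∈L♯ z = subst IsIntegral
      (sym (trans (Bℚ-*ˡ G ½ (ιᵛ y) (ιᵛ z)) (trans (cong (½ ℚ.*_) (Bℚ-ι G y z)) (ℚP.*-comm ½ (ι (Bℤ G y z))))))
      (∣⇒integral (Bℤ G y z) 2 (∣-Bℤ G y z G-even))
    a b : ℤ
    a = proj₁ (surj v v∈L♯)
    b = proj₁ (proj₂ (surj v v∈L♯))
    v∼φ : v ∼ φ a b
    v∼φ = mk∼ (proj₂ (proj₂ (surj v v∈L♯)))
    2v∈L : InL (φ (+ 2 ℤ.* a) (+ 2 ℤ.* b))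
    2v∈L = InL-resp-∼ (∼-trans (φ-·ℕ 2 a b) (∼-trans (∼-·ᵛ (+ 2) (∼-sym v∼φ)) 2v∼y)) (InL-ιᵛ y)
      where
      2v∼y : ι (+ 2) ·ᵛ v ∼ ιᵛ y
      2v∼y = ∼-reflexive λ i → trans (sym (ℚP.*-assoc (ι (+ 2)) ½ (ι (y i)))) (ℚP.*-identityˡ (ι (y i)))
    h∣ : ∀ c → + N S.∣ + 2 ℤ.* c → + h S.∣ c
    h∣ c N∣2c = S.*-cancelˡ-∣ (+ 2) (subst (S._∣ + 2 ℤ.* c) (ℤP.pos-* 2 h) N∣2c)
    h∣a = h∣ a (proj₁ (φ∈L⇒∣ _ _ 2v∈L))
    h∣b = h∣ b (proj₂ (φ∈L⇒∣ _ _ 2v∈L))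
    α β : ℤ
    α = S._∣_.quotient h∣a
    β = S._∣_.quotient h∣b
    v∼comb : v ∼ ι (+ h) ·ᵛ ((ι α ·ᵛ φ (+ 1) (+ 0)) +ᵥ (ι β ·ᵛ φ (+ 0) (+ 1)))
    v∼comb = ∼-trans v∼φ (∼-trans
      (φ-cong (trans (S._∣_.equality h∣a) (ℤP.*-comm α (+ h))) (trans (S._∣_.equality h∣b) (ℤP.*-comm β (+ h))))
      (∼-trans (φ-·ℕ h α β) (∼-·ᵛ (+ h) (φ-linear α β))))
    component : ∀ i → (v -ᵥ (ι (+ h) ·ᵛ ((ι α ·ᵛ φ (+ 1) (+ 0)) +ᵥ (ι β ·ᵛ φ (+ 0) (+ 1))))) i
                      ≡ ι (y i ℤ.- (α ℤ.* w₁ i ℤ.+ β ℤ.* w₂ i)) ℚ.* inv 2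
    component i = begin
      ½ ℚ.* Y ℚ.- ι (+ h) ℚ.* (ι α ℚ.* φ (+ 1) (+ 0) i ℚ.+ ι β ℚ.* φ (+ 0) (+ 1) i)
        ≡⟨ cong₂ (λ f₁ f₂ → ½ ℚ.* Y ℚ.- ι (+ h) ℚ.* (ι α ℚ.* f₁ ℚ.+ ι β ℚ.* f₂))
                 (φ≡inv*Nφ (+ 1) (+ 0) i) (φ≡inv*Nφ (+ 0) (+ 1) i) ⟩
      ½ ℚ.* Y ℚ.- ι (+ h) ℚ.* (ι α ℚ.* (inv N ℚ.* W₁) ℚ.+ ι β ℚ.* (inv N ℚ.* W₂))
        ≡⟨ regroup ½ Y (ι (+ h)) (inv N) (ι α) (ι β) W₁ W₂ ⟩
      ½ ℚ.* Y ℚ.- ι (+ h) ℚ.* inv N ℚ.* (ι α ℚ.* W₁ ℚ.+ ι β ℚ.* W₂)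
        ≡⟨ cong (λ c → ½ ℚ.* Y ℚ.- c ℚ.* (ι α ℚ.* W₁ ℚ.+ ι β ℚ.* W₂)) ι-h*inv-N ⟩
      ½ ℚ.* Y ℚ.- ½ ℚ.* (ι α ℚ.* W₁ ℚ.+ ι β ℚ.* W₂)
        ≡⟨ factor ½ Y (ι α ℚ.* W₁ ℚ.+ ι β ℚ.* W₂) ⟩
      (Y ℚ.- (ι α ℚ.* W₁ ℚ.+ ι β ℚ.* W₂)) ℚ.* ½
        ≡⟨ cong (ℚ._* ½) (sym ι-comb) ⟩
      ι (y i ℤ.- (α ℤ.* w₁ i ℤ.+ β ℤ.* w₂ i)) ℚ.* inv 2 ∎
      where
      open ≡-Reasoning
      Y W₁ W₂ : ℚ
      Y  = ι (y i)
      W₁ = ι (w₁ i)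
      W₂ = ι (w₂ i)
      regroup : ∀ c y k i a b u v → c ℚ.* y ℚ.- k ℚ.* (a ℚ.* (i ℚ.* u) ℚ.+ b ℚ.* (i ℚ.* v))
                                   ≡ c ℚ.* y ℚ.- k ℚ.* i ℚ.* (a ℚ.* u ℚ.+ b ℚ.* v)
      regroup = solve-∀-in ℚ-ring
      factor : ∀ c y s → c ℚ.* y ℚ.- c ℚ.* s ≡ (y ℚ.- s) ℚ.* c
      factor = solve-∀-in ℚ-ring
      ι-comb : ι (y i ℤ.- (α ℤ.* w₁ i ℤ.+ β ℤ.* w₂ i)) ≡ Y ℚ.- (ι α ℚ.* W₁ ℚ.+ ι β ℚ.* W₂)
      ι-comb = trans (ι-- (y i) _) (cong (λ s → Y ℚ.- s)
        (trans (ι-+ (α ℤ.* w₁ i) (β ℤ.* w₂ i)) (cong₂ ℚ._+_ (ι-* α (w₁ i)) (ι-* β (w₂ i)))))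

-- Rank at most one

module _ (h : ℕ) {{_ : NonZero h}} {q : ℤ → ℤ → ℚ} where

  ¬DiscIso-rank0 : (G : Mat 0) → ¬ DiscIso (2 ℕ.* h) q G
  ¬DiscIso-rank0 G D = ¬even-w₁ λ ()
    where open HalfOrder h D

  ¬DiscIso-rank1 : (G : Mat 1) → ¬ DiscIso (2 ℕ.* h) q G
  ¬DiscIso-rank1 G D =
    [ (λ e → ¬even-w₁ λ { zero → e })
    , [ (λ e → ¬even-w₂ λ { zero → e }) , (λ e → ¬even-w₁+w₂ λ { zero → e }) ]′ ]′
    (2∣-one-of (w₁ zero) (w₂ zero))
    where open HalfOrder h D

-- Rank three

all₃ : (Fin 3 → Bool) → Bool
all₃ f = f zero ∧ (f (suc zero) ∧ f (suc (suc zero)))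

all₃-intro : ∀ {f} → (∀ i → f i ≡ true) → all₃ f ≡ true
all₃-intro {f} e rewrite e zero | e (suc zero) | e (suc (suc zero)) = refl

all₃-elim : ∀ {f} → all₃ f ≡ true → ∀ i → f i ≡ true
all₃-elim {f} e zero             = BoolP.∧-conicalˡ (f zero) _ e
all₃-elim {f} e (suc zero)       = BoolP.∧-conicalˡ (f (suc zero)) _ (BoolP.∧-conicalʳ (f zero) _ e)
all₃-elim {f} e (suc (suc zero)) = BoolP.∧-conicalʳ (f (suc zero)) _ (BoolP.∧-conicalʳ (f zero) _ e)

all₃-cong : ∀ {f g} → (∀ i → f i ≡ g i) → all₃ f ≡ all₃ g
all₃-cong e = cong₂ _∧_ (e zero) (cong₂ _∧_ (e (suc zero)) (e (suc (suc zero))))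

not≡true : ∀ {x} → not x ≡ true → x ≡ false
not≡true {false} _ = refl

implied : ∀ {H C} → not H ∨ C ≡ true → H ≡ true → C ≡ true
implied e refl = e

-- Vectors and matrices over 𝔽₂, with 𝔽₂ modelled by Bool, _xor_ and _∧_.
⟨_,_,_⟩ : Bool → Bool → Bool → Fin 3 → Bool
⟨ x , y , z ⟩ zero             = x
⟨ x , y , z ⟩ (suc zero)       = y
⟨ x , y , z ⟩ (suc (suc zero)) = z

nonzero₃ : (Fin 3 → Bool) → Bool
nonzero₃ p = not (all₃ (λ i → not (p i)))

kills : (Fin 3 → Fin 3 → Bool) → (Fin 3 → Bool) → Bool
kills A p = all₃ λ l → not (parity (λ k → p k ∧ A k l))

alternating₃ : Bool → Bool → Bool → Fin 3 → Fin 3 → Bool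
alternating₃ a b c = λ where
  zero             → ⟨ false , a , b ⟩
  (suc zero)       → ⟨ a , false , c ⟩
  (suc (suc zero)) → ⟨ b , c , false ⟩

-- A nonzero alternating 3 × 3 matrix over 𝔽₂ has rank 2, so its kernel contains
-- a single nonzero vector.
alternating₃-kernel-check : Vec Bool 9 → Bool
alternating₃-kernel-check (p₀ ∷ p₁ ∷ p₂ ∷ q₀ ∷ q₁ ∷ q₂ ∷ a ∷ b ∷ c ∷ []) =
  not (kills A p ∧ (kills A q ∧ (nonzero₃ p ∧ (nonzero₃ q ∧ nonzero₃ (λ i → p i xor q i)))))
  ∨ all₃ (λ k → all₃ (λ l → not (A k l)))
  where
  A = alternating₃ a b c
  p = ⟨ p₀ , p₁ , p₂ ⟩
  q = ⟨ q₀ , q₁ , q₂ ⟩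

spans : (Fin 3 → Bool) → (Fin 3 → Bool) → Fin 3 → Bool → Bool → Bool
spans p q k x y = all₃ λ i → not (Bit-odd (basis-Bit k i) xor ((x ∧ p i) xor (y ∧ q i)))

span₃-check : Vec Bool 12 → Bool
span₃-check (p₀ ∷ p₁ ∷ p₂ ∷ q₀ ∷ q₁ ∷ q₂ ∷ x₀ ∷ y₀ ∷ x₁ ∷ y₁ ∷ x₂ ∷ y₂ ∷ []) =
  not (spans p q zero x₀ y₀ ∧ (spans p q (suc zero) x₁ y₁ ∧ spans p q (suc (suc zero)) x₂ y₂)) ∨ false
  where
  p = ⟨ p₀ , p₁ , p₂ ⟩
  q = ⟨ q₀ , q₁ , q₂ ⟩

¬span₃ : ∀ p q (x y : Fin 3 → Bool) → ¬ (∀ k → spans p q k (x k) (y k) ≡ true)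
¬span₃ p q x y s = false≢true (implied
  (allV-sound 12 span₃-check refl
    (p zero ∷ p (suc zero) ∷ p (suc (suc zero)) ∷ q zero ∷ q (suc zero) ∷ q (suc (suc zero)) ∷
     x zero ∷ y zero ∷ x (suc zero) ∷ y (suc zero) ∷ x (suc (suc zero)) ∷ y (suc (suc zero)) ∷ []))
  (cong₂ _∧_ (s zero) (cong₂ _∧_ (s (suc zero)) (s (suc (suc zero))))))
  where
  false≢true : false ≢ true
  false≢true ()

module Rank3 (h : ℕ) {{_ : NonZero h}} {q : ℤ → ℤ → ℚ} (G : Mat 3)
             (G-sym : IsSymmetric G) (G-even : IsEven G) (D : DiscIso (2 ℕ.* h) q G) where
  open HalfOrder h D

  g : Fin 3 → Fin 3 → Bool
  g k l = odd (G k l)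

  g-diag : ∀ k → g k k ≡ false
  g-diag k = 2∣⇒odd≡false (subst (+ 2 S.∣_) (Bℤ-basis G k k) (S.∣ᵤ⇒∣ (G-even (basis k))))

  A : Fin 3 → Fin 3 → Bool
  A = alternating₃ (g zero (suc zero)) (g zero (suc (suc zero))) (g (suc zero) (suc (suc zero)))

  g≡alternating₃ : ∀ k l → g k l ≡ A k l
  g≡alternating₃ zero             zero             = g-diag zero
  g≡alternating₃ zero             (suc zero)       = refl
  g≡alternating₃ zero             (suc (suc zero)) = refl
  g≡alternating₃ (suc zero)       zero             = cong odd (G-sym _ _)
  g≡alternating₃ (suc zero)       (suc zero)       = g-diag (suc zero)
  g≡alternating₃ (suc zero)       (suc (suc zero)) = refl
  g≡alternating₃ (suc (suc zero)) zero             = cong odd (G-sym _ _)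
  g≡alternating₃ (suc (suc zero)) (suc zero)       = cong odd (G-sym _ _)
  g≡alternating₃ (suc (suc zero)) (suc (suc zero)) = g-diag (suc (suc zero))

  P Q : Fin 3 → Bool
  P i = odd (w₁ i)
  Q i = odd (w₂ i)

  kills-Nφ : ∀ a b → kills A (λ k → odd (Nφ a b k)) ≡ true
  kills-Nφ a b = all₃-intro λ l → cong not (begin
    parity (λ k → odd (Nφ a b k) ∧ A k l)
      ≡⟨ parity-cong (λ k → cong (odd (Nφ a b k) ∧_) (g≡alternating₃ k l)) ⟨
    parity (λ k → odd (Nφ a b k) ∧ g k l)
      ≡⟨ parity-cong {f = λ k → odd (Nφ a b k ℤ.* G k l)} (λ k → odd-* (Nφ a b k) (G k l)) ⟨
    parity (λ k → odd (Nφ a b k ℤ.* G k l))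
      ≡⟨ odd-sumℤ (λ k → Nφ a b k ℤ.* G k l) ⟨
    odd (sumℤ (λ k → Nφ a b k ℤ.* G k l))
      ≡⟨ cong odd (Bℤ-basisʳ G (Nφ a b) l) ⟨
    odd (Bℤ G (Nφ a b) (basis l))
      ≡⟨ 2∣⇒odd≡false (S.∣-trans 2∣N (N∣Bℤ-Nφ a b (basis l))) ⟩
    false ∎)
    where
    open ≡-Reasoning
    2∣N : + 2 S.∣ + N
    2∣N = S.divides (+ h) (trans (ℤP.pos-* 2 h) (ℤP.*-comm (+ 2) (+ h)))

  nonzero : (w : ℤVec 3) → ¬ Evenᵛ w → nonzero₃ (λ i → odd (w i)) ≡ true
  nonzero w w-odd with odd (w zero) in o₀ | odd (w (suc zero)) in o₁ | odd (w (suc (suc zero))) in o₂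
  ... | true  | _     | _     = refl
  ... | false | true  | _     = refl
  ... | false | false | true  = refl
  ... | false | false | false =
    ⊥-elim (w-odd λ { zero → odd≡false⇒2∣ o₀ ; (suc zero) → odd≡false⇒2∣ o₁ ; (suc (suc zero)) → odd≡false⇒2∣ o₂ })

  G≡0-mod-2 : ∀ k l → + 2 S.∣ G k l
  G≡0-mod-2 k l = odd≡false⇒2∣ (trans (g≡alternating₃ k l)
    (not≡true (all₃-elim {λ l → not (A k l)} (all₃-elim {λ k → all₃ (λ l → not (A k l))} A≡0 k) l)))
    where
    A≡0 : all₃ (λ k → all₃ (λ l → not (A k l))) ≡ true
    A≡0 = implied
      (allV-sound 9 alternating₃-kernel-check refl
        (P zero ∷ P (suc zero) ∷ P (suc (suc zero)) ∷ Q zero ∷ Q (suc zero) ∷ Q (suc (suc zero)) ∷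
         g zero (suc zero) ∷ g zero (suc (suc zero)) ∷ g (suc zero) (suc (suc zero)) ∷ []))
      (cong₂ _∧_ (kills-Nφ (+ 1) (+ 0)) (cong₂ _∧_ (kills-Nφ (+ 0) (+ 1))
        (cong₂ _∧_ (nonzero w₁ ¬even-w₁) (cong₂ _∧_ (nonzero w₂ ¬even-w₂)
          (trans (cong not (all₃-cong λ i → cong not (sym (odd-+ (w₁ i) (w₂ i)))))
                 (nonzero (λ i → w₁ i ℤ.+ w₂ i) ¬even-w₁+w₂))))))

  spans-basis : ∀ k α β → Evenᵛ (λ i → basis k i ℤ.- (α ℤ.* w₁ i ℤ.+ β ℤ.* w₂ i)) →
                spans P Q k (odd α) (odd β) ≡ true
  spans-basis k α β even = all₃-intro λ i → cong not (begin
    Bit-odd (basis-Bit k i) xor ((odd α ∧ P i) xor (odd β ∧ Q i))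
      ≡⟨ cong₂ _xor_ (odd-Bit (basis-Bit k i))
           (trans (odd-+ (α ℤ.* w₁ i) (β ℤ.* w₂ i)) (cong₂ _xor_ (odd-* α (w₁ i)) (odd-* β (w₂ i)))) ⟨
    odd (basis k i) xor odd (α ℤ.* w₁ i ℤ.+ β ℤ.* w₂ i)
      ≡⟨ odd-- (basis k i) _ ⟨
    odd (basis k i ℤ.- (α ℤ.* w₁ i ℤ.+ β ℤ.* w₂ i))
      ≡⟨ 2∣⇒odd≡false (even i) ⟩
    false ∎)
    where open ≡-Reasoning

  contradiction : ⊥
  contradiction = ¬span₃ P Q (λ k → odd (α k)) (λ k → odd (β k)) λ k →
    spans-basis k (α k) (β k) (proj₂ (proj₂ (span-mod-2 G≡0-mod-2 (basis k))))
    where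
    α β : Fin 3 → ℤ
    α k = proj₁ (span-mod-2 G≡0-mod-2 (basis k))
    β k = proj₁ (proj₂ (span-mod-2 G≡0-mod-2 (basis k)))

¬DiscIso-rank3 : ∀ h {{_ : NonZero h}} {q} (G : Mat 3) → IsSymmetric G → IsEven G → ¬ DiscIso (2 ℕ.* h) q G
¬DiscIso-rank3 h {q} G G-sym G-even D = Rank3.contradiction h {q} G G-sym G-even D

-- Rank two

odd-cancel : ∀ m {d} x → odd d ≡ true → + (2 ℕ.^ m) S.∣ d ℤ.* x → + (2 ℕ.^ m) S.∣ x
odd-cancel zero    x _ _ = S.divides x (sym (ℤP.*-identityʳ x))
odd-cancel (suc m) {d} x d-odd 2^m⁺¹∣dx with odd≡false⇒2∣ {x} x-even
  where
  2∣2^m⁺¹ : + 2 S.∣ + (2 ℕ.^ suc m)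
  2∣2^m⁺¹ = S.divides (+ (2 ℕ.^ m)) (trans (ℤP.pos-* 2 (2 ℕ.^ m)) (ℤP.*-comm (+ 2) (+ (2 ℕ.^ m))))
  x-even : odd x ≡ false
  x-even = trans (cong (_∧ odd x) (sym d-odd)) (trans (sym (odd-* d x)) (2∣⇒odd≡false (S.∣-trans 2∣2^m⁺¹ 2^m⁺¹∣dx)))
... | S.divides x′ refl = subst (S._∣ x′ ℤ.* + 2) (sym (trans (cong +_ (ℕP.*-comm 2 (2 ℕ.^ m))) (ℤP.pos-* (2 ℕ.^ m) 2)))
      (S.*-monoˡ-∣ (+ 2) (odd-cancel m x′ d-odd (S.*-cancelˡ-∣ (+ 2) 2·2^m∣2dx′)))
  where
  2·2^m∣2dx′ : + 2 ℤ.* + (2 ℕ.^ m) S.∣ + 2 ℤ.* (d ℤ.* x′)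
  2·2^m∣2dx′ = subst₂ S._∣_ (ℤP.pos-* 2 (2 ℕ.^ m)) (regroup d x′) 2^m⁺¹∣dx
    where
    regroup : ∀ d x′ → d ℤ.* (x′ ℤ.* + 2) ≡ + 2 ℤ.* (d ℤ.* x′)
    regroup = ℤ-solve

odd⇒1+2k : ∀ {d} → odd d ≡ true → Σ ℤ λ k → d ≡ + 1 ℤ.+ + 2 ℤ.* k
odd⇒1+2k {d} d-odd with odd≡false⇒2∣ {d ℤ.- + 1} (trans (odd-- d (+ 1)) (cong₂ _xor_ d-odd (odd-Bit bit1)))
... | S.divides k d-1≡2k = k , (begin
  d                         ≡⟨ ℤ-solve′ d ⟩
  + 1 ℤ.+ (d ℤ.- + 1)       ≡⟨ cong (λ e → + 1 ℤ.+ e) (trans d-1≡2k (ℤP.*-comm k (+ 2))) ⟩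
  + 1 ℤ.+ + 2 ℤ.* k         ∎)
  where
  open ≡-Reasoning
  ℤ-solve′ : ∀ d → d ≡ + 1 ℤ.+ (d ℤ.- + 1)
  ℤ-solve′ = ℤ-solve

2∣k[k+1] : ∀ k → + 2 S.∣ k ℤ.* (k ℤ.+ + 1)
2∣k[k+1] k = odd≡false⇒2∣ (trans (odd-* k (k ℤ.+ + 1))
  (trans (cong (odd k ∧_) (trans (odd-+ k (+ 1)) (cong (odd k xor_) (odd-Bit bit1)))) (x∧[x⊕1] (odd k))))
  where
  x∧[x⊕1] : ∀ x → x ∧ (x xor true) ≡ false
  x∧[x⊕1] false = refl
  x∧[x⊕1] true  = refl

8∣odd²-1 : ∀ k → + 8 S.∣ (+ 1 ℤ.+ + 2 ℤ.* k) ℤ.* (+ 1 ℤ.+ + 2 ℤ.* k) ℤ.- + 1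
8∣odd²-1 k with 2∣k[k+1] k
... | S.divides l k[k+1]≡2l = S.divides l (begin
  (+ 1 ℤ.+ + 2 ℤ.* k) ℤ.* (+ 1 ℤ.+ + 2 ℤ.* k) ℤ.- + 1  ≡⟨ expand k ⟩
  + 4 ℤ.* (k ℤ.* (k ℤ.+ + 1))                          ≡⟨ cong (+ 4 ℤ.*_) k[k+1]≡2l ⟩
  + 4 ℤ.* (l ℤ.* + 2)                                  ≡⟨ regroup l ⟩
  l ℤ.* + 8                                            ∎)
  where
  open ≡-Reasoning
  expand : ∀ k → (+ 1 ℤ.+ + 2 ℤ.* k) ℤ.* (+ 1 ℤ.+ + 2 ℤ.* k) ℤ.- + 1 ≡ + 4 ℤ.* (k ℤ.* (k ℤ.+ + 1))
  expand = ℤ-solve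
  regroup : ∀ l → + 4 ℤ.* (l ℤ.* + 2) ≡ l ℤ.* + 8
  regroup = ℤ-solve

sumℤ-*ˡ : ∀ {n} (c : ℤ) (f : Fin n → ℤ) → sumℤ (λ i → c ℤ.* f i) ≡ c ℤ.* sumℤ f
sumℤ-*ˡ {zero}  c f = sym (ℤP.*-zeroʳ c)
sumℤ-*ˡ {suc n} c f = trans (cong (λ s → c ℤ.* f zero ℤ.+ s) (sumℤ-*ˡ c (λ i → f (suc i))))
                            (sym (ℤP.*-distribˡ-+ c _ _))

sumℤ-cong : ∀ {n} {f g : Fin n → ℤ} → (∀ i → f i ≡ g i) → sumℤ f ≡ sumℤ g
sumℤ-cong {zero}  e = refl
sumℤ-cong {suc n} e = cong₂ ℤ._+_ (e zero) (sumℤ-cong (λ i → e (suc i)))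

Bℤ-scale : ∀ {n} {G U : Mat n} (c : ℤ) → (∀ i j → G i j ≡ c ℤ.* U i j) →
           ∀ x y → Bℤ G x y ≡ c ℤ.* Bℤ U x y
Bℤ-scale {n} {G} {U} c G≡cU x y = trans
  (sumℤ-cong λ i → trans (sumℤ-cong λ j → trans (cong (λ g → x i ℤ.* g ℤ.* y j) (G≡cU i j)) (regroup c (x i) (U i j) (y j)))
                         (sumℤ-*ˡ {n} c (λ j → x i ℤ.* U i j ℤ.* y j)))
  (sumℤ-*ˡ {n} c (λ i → sumℤ (λ j → x i ℤ.* U i j ℤ.* y j)))
  where
  regroup : ∀ c a u b → a ℤ.* (c ℤ.* u) ℤ.* b ≡ c ℤ.* (a ℤ.* u ℤ.* b)
  regroup = ℤ-solve

vec₂ : ∀ {A : Set} → A → A → Fin 2 → A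
vec₂ a b zero       = a
vec₂ a b (suc zero) = b

sym₂ : ∀ {A : Set} → A → A → A → Fin 2 → Fin 2 → A
sym₂ a b c zero       = vec₂ a b
sym₂ a b c (suc zero) = vec₂ b c

module _ (a b c : ℤ) where
  private
    U : Mat 2
    U = sym₂ a b c

  form₂-expand : ∀ (x y z : ℤVec 2) t →
    Bℤ U (λ i → x i ℤ.+ y i ℤ.+ + 2 ℤ.* t ℤ.* z i) (λ i → x i ℤ.+ y i ℤ.+ + 2 ℤ.* t ℤ.* z i)
    ≡ Bℤ U x x ℤ.+ + 2 ℤ.* Bℤ U x y ℤ.+ Bℤ U y y
      ℤ.+ + 4 ℤ.* (t ℤ.* Bℤ U (λ i → x i ℤ.+ y i) z ℤ.+ t ℤ.* t ℤ.* Bℤ U z z)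
  form₂-expand x y z t =
    prove (a ∷ b ∷ c ∷ x zero ∷ x (suc zero) ∷ y zero ∷ y (suc zero) ∷ z zero ∷ z (suc zero) ∷ t ∷ [])
      (B (λ i → X i :+ Y i :+ con (+ 2) :* T :* Z i) (λ i → X i :+ Y i :+ con (+ 2) :* T :* Z i))
      (B X X :+ con (+ 2) :* B X Y :+ B Y Y :+ con (+ 4) :* (T :* B (λ i → X i :+ Y i) Z :+ T :* T :* B Z Z))
      refl
    where
    X Y Z : Fin 2 → Polynomial 10
    X = vec₂ (var (# 3)) (var (# 4))
    Y = vec₂ (var (# 5)) (var (# 6))
    Z = vec₂ (var (# 7)) (var (# 8))
    T = var (# 9)
    B = Bᴾ (sym₂ (var (# 0)) (var (# 1)) (var (# 2)))

  form₂-gram-det : ∀ (x y : ℤVec 2) →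
    Bℤ U x x ℤ.* Bℤ U y y ℤ.- Bℤ U x y ℤ.* Bℤ U x y
    ≡ (x zero ℤ.* y (suc zero) ℤ.- x (suc zero) ℤ.* y zero) ℤ.* (x zero ℤ.* y (suc zero) ℤ.- x (suc zero) ℤ.* y zero)
      ℤ.* (a ℤ.* c ℤ.- b ℤ.* b)
  form₂-gram-det x y =
    prove (a ∷ b ∷ c ∷ x zero ∷ x (suc zero) ∷ y zero ∷ y (suc zero) ∷ [])
      (B X X :* B Y Y :- B X Y :* B X Y)
      ((x₀ :* y₁ :- x₁ :* y₀) :* (x₀ :* y₁ :- x₁ :* y₀) :* (var (# 0) :* var (# 2) :- var (# 1) :* var (# 1)))
      refl
    where
    x₀ = var (# 3) ; x₁ = var (# 4) ; y₀ = var (# 5) ; y₁ = var (# 6)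
    X Y : Fin 2 → Polynomial 7
    X = vec₂ x₀ x₁
    Y = vec₂ y₀ y₁
    B = Bᴾ (sym₂ (var (# 0)) (var (# 1)) (var (# 2)))

  adjugate₂ : Fin 2 → ℤVec 2
  adjugate₂ = sym₂ c (ℤ.- b) a

  form₂-adjugate : ∀ j (z : ℤVec 2) → Bℤ U (adjugate₂ j) z ≡ (a ℤ.* c ℤ.- b ℤ.* b) ℤ.* z j
  form₂-adjugate zero z =
    prove (a ∷ b ∷ c ∷ z zero ∷ z (suc zero) ∷ [])
      (Bᴾ Uᴾ (vec₂ cᴾ (:- bᴾ)) Z) ((aᴾ :* cᴾ :- bᴾ :* bᴾ) :* Z zero) refl
    where
    aᴾ = var (# 0) ; bᴾ = var (# 1) ; cᴾ = var (# 2)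
    Uᴾ = sym₂ aᴾ bᴾ cᴾ
    Z : Fin 2 → Polynomial 5
    Z = vec₂ (var (# 3)) (var (# 4))
  form₂-adjugate (suc zero) z =
    prove (a ∷ b ∷ c ∷ z zero ∷ z (suc zero) ∷ [])
      (Bᴾ Uᴾ (vec₂ (:- bᴾ) aᴾ) Z) ((aᴾ :* cᴾ :- bᴾ :* bᴾ) :* Z (suc zero)) refl
    where
    aᴾ = var (# 0) ; bᴾ = var (# 1) ; cᴾ = var (# 2)
    Uᴾ = sym₂ aᴾ bᴾ cᴾ
    Z : Fin 2 → Polynomial 5
    Z = vec₂ (var (# 3)) (var (# 4))

-- Two vectors p, q of 𝔽₂² with p, q and p + q nonzero form a basis.
basis₂-check : Vec Bool 4 → Bool
basis₂-check (p₀ ∷ p₁ ∷ q₀ ∷ q₁ ∷ []) =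
  not ((p₀ ∨ p₁) ∧ ((q₀ ∨ q₁) ∧ ((p₀ xor q₀) ∨ (p₁ xor q₁)))) ∨ ((p₀ ∧ q₁) xor (p₁ ∧ q₀))

nonzero₂ : (w : ℤVec 2) → ¬ Evenᵛ w → odd (w zero) ∨ odd (w (suc zero)) ≡ true
nonzero₂ w w-odd with odd (w zero) in o₀ | odd (w (suc zero)) in o₁
... | true  | _     = refl
... | false | true  = refl
... | false | false = ⊥-elim (w-odd λ { zero → odd≡false⇒2∣ o₀ ; (suc zero) → odd≡false⇒2∣ o₁ })

Bℤ-cong : ∀ {n} (G : Mat n) {x x' y y' : ℤVec n} → (∀ i → x i ≡ x' i) → (∀ i → y i ≡ y' i) →
          Bℤ G x y ≡ Bℤ G x' y'
Bℤ-cong G ex ey = sumℤ-cong λ i → sumℤ-cong λ j → cong₂ (λ a b → a ℤ.* G i j ℤ.* b) (ex i) (ey j)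

module Rank2 (r : ℕ) (G : Mat 2) (G-sym : IsSymmetric G) (D : DiscIsoB (suc r) G) where
  h : ℕ
  h = pow2 r

  instance
    h≢0 : NonZero h
    h≢0 = pow2-nonZero r

  open DiscIso D
  open HalfOrder h D

  x₀ x₁ y₀ y₁ : ℤ
  x₀ = w₁ zero ; x₁ = w₁ (suc zero) ; y₀ = w₂ zero ; y₁ = w₂ (suc zero)

  d : ℤ
  d = x₀ ℤ.* y₁ ℤ.- x₁ ℤ.* y₀

  d-odd : odd d ≡ true
  d-odd = begin
    odd d
      ≡⟨ trans (odd-- _ _) (cong₂ _xor_ (odd-* x₀ y₁) (odd-* x₁ y₀)) ⟩
    (P₀ ∧ Q₁) xor (P₁ ∧ Q₀)
      ≡⟨ implied (allV-sound 4 basis₂-check refl (P₀ ∷ P₁ ∷ Q₀ ∷ Q₁ ∷ []))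
           (cong₂ _∧_ (nonzero₂ w₁ ¬even-w₁) (cong₂ _∧_ (nonzero₂ w₂ ¬even-w₂)
             (trans (sym (cong₂ _∨_ (odd-+ x₀ y₀) (odd-+ x₁ y₁)))
                    (nonzero₂ (λ i → w₁ i ℤ.+ w₂ i) ¬even-w₁+w₂)))) ⟩
    true ∎
    where
    open ≡-Reasoning
    P₀ = odd x₀ ; P₁ = odd x₁ ; Q₀ = odd y₀ ; Q₁ = odd y₁

  N∣column : ∀ a b i → + N S.∣ Nφ a b zero ℤ.* G zero i ℤ.+ Nφ a b (suc zero) ℤ.* G (suc zero) i
  N∣column a b i = subst (+ N S.∣_)
    (trans (Bℤ-basisʳ G (Nφ a b) i) (cong (λ s → Nφ a b zero ℤ.* G zero i ℤ.+ s) (ℤP.+-identityʳ _)))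
    (N∣Bℤ-Nφ a b (basis i))

  -- Cramer's rule: d · G k i is an integer combination of the columns above.
  N∣G : ∀ k i → + N S.∣ G k i
  N∣G zero i = odd-cancel (suc r) (G zero i) d-odd (subst (+ N S.∣_) (sym (cramer₀ x₀ x₁ y₀ y₁ (G zero i) (G (suc zero) i)))
    (S.∣m∣n⇒∣m-n (S.∣n⇒∣m*n y₁ (N∣column (+ 1) (+ 0) i)) (S.∣n⇒∣m*n x₁ (N∣column (+ 0) (+ 1) i))))
    where
    cramer₀ : ∀ x₀ x₁ y₀ y₁ g₀ g₁ →
      (x₀ ℤ.* y₁ ℤ.- x₁ ℤ.* y₀) ℤ.* g₀ ≡ y₁ ℤ.* (x₀ ℤ.* g₀ ℤ.+ x₁ ℤ.* g₁) ℤ.- x₁ ℤ.* (y₀ ℤ.* g₀ ℤ.+ y₁ ℤ.* g₁)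
    cramer₀ = ℤ-solve
  N∣G (suc zero) i = odd-cancel (suc r) (G (suc zero) i) d-odd (subst (+ N S.∣_) (sym (cramer₁ x₀ x₁ y₀ y₁ (G zero i) (G (suc zero) i)))
    (S.∣m∣n⇒∣m-n (S.∣n⇒∣m*n x₀ (N∣column (+ 0) (+ 1) i)) (S.∣n⇒∣m*n y₀ (N∣column (+ 1) (+ 0) i))))
    where
    cramer₁ : ∀ x₀ x₁ y₀ y₁ g₀ g₁ →
      (x₀ ℤ.* y₁ ℤ.- x₁ ℤ.* y₀) ℤ.* g₁ ≡ x₀ ℤ.* (y₀ ℤ.* g₀ ℤ.+ y₁ ℤ.* g₁) ℤ.- y₀ ℤ.* (x₀ ℤ.* g₀ ℤ.+ x₁ ℤ.* g₁)
    cramer₁ = ℤ-solve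

  opaque
    u₀₀ u₀₁ u₁₁ : ℤ
    u₀₀ = S._∣_.quotient (N∣G zero zero)
    u₀₁ = S._∣_.quotient (N∣G zero (suc zero))
    u₁₁ = S._∣_.quotient (N∣G (suc zero) (suc zero))

    G≡N*U : ∀ k i → G k i ≡ + N ℤ.* sym₂ u₀₀ u₀₁ u₁₁ k i
    G≡N*U zero       zero       = trans (S._∣_.equality (N∣G zero zero)) (ℤP.*-comm u₀₀ (+ N))
    G≡N*U zero       (suc zero) = trans (S._∣_.equality (N∣G zero (suc zero))) (ℤP.*-comm u₀₁ (+ N))
    G≡N*U (suc zero) zero       = trans (G-sym (suc zero) zero) (G≡N*U zero (suc zero))
    G≡N*U (suc zero) (suc zero) = trans (S._∣_.equality (N∣G (suc zero) (suc zero))) (ℤP.*-comm u₁₁ (+ N))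

  U : Mat 2
  U = sym₂ u₀₀ u₀₁ u₁₁

  M : ℤ → ℤ → ℤ
  M a b = Bℤ U (Nφ a b) (Nφ a b)

  qDisc-φ : ∀ a b → qDisc G (φ a b) ≡ ι (M a b) ℚ.* (½ ℚ.* inv N)
  qDisc-φ a b = begin
    ½ ℚ.* Bℚ G (φ a b) (φ a b)
      ≡⟨ cong (½ ℚ.*_) (Bℚ-cong G (φ≡inv*Nφ a b) (φ≡inv*Nφ a b)) ⟩
    ½ ℚ.* Bℚ G (inv N ·ᵛ ιᵛ w) (inv N ·ᵛ ιᵛ w)
      ≡⟨ cong (½ ℚ.*_) (trans (Bℚ-*ˡ G (inv N) (ιᵛ w) (inv N ·ᵛ ιᵛ w)) (cong (inv N ℚ.*_) (Bℚ-*ʳ G (inv N) (ιᵛ w) (ιᵛ w)))) ⟩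
    ½ ℚ.* (inv N ℚ.* (inv N ℚ.* Bℚ G (ιᵛ w) (ιᵛ w)))
      ≡⟨ cong (λ s → ½ ℚ.* (inv N ℚ.* (inv N ℚ.* s))) (trans (Bℚ-ι G w w) (trans (cong ι (Bℤ-scale (+ N) G≡N*U w w)) (ι-* (+ N) (M a b)))) ⟩
    ½ ℚ.* (inv N ℚ.* (inv N ℚ.* (ι (+ N) ℚ.* ι (M a b))))
      ≡⟨ regroup ½ (inv N) (ι (+ N)) (ι (M a b)) ⟩
    ι (M a b) ℚ.* (½ ℚ.* inv N) ℚ.* (inv N ℚ.* ι (+ N))
      ≡⟨ cong (ι (M a b) ℚ.* (½ ℚ.* inv N) ℚ.*_) (inv*ι N) ⟩
    ι (M a b) ℚ.* (½ ℚ.* inv N) ℚ.* ℚ.1ℚ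
      ≡⟨ ℚP.*-identityʳ _ ⟩
    ι (M a b) ℚ.* (½ ℚ.* inv N) ∎
    where
    open ≡-Reasoning
    w = Nφ a b
    regroup : ∀ c i n m → c ℚ.* (i ℚ.* (i ℚ.* (n ℚ.* m))) ≡ m ℚ.* (c ℚ.* i) ℚ.* (i ℚ.* n)
    regroup = solve-∀-in ℚ-ring

  QB : ℤ → ℤ → ℤ
  QB a b = a ℤ.* a ℤ.+ a ℤ.* b ℤ.+ b ℤ.* b

  -- Multiplying the isometry condition by h turns q_B(a, b) = QB a b / 2h into QB a b / 2.
  M≡2QB-mod-4 : ∀ a b → + 4 S.∣ M a b ℤ.- + 2 ℤ.* QB a b
  M≡2QB-mod-4 a b = integral⇒∣ _ 4 (subst IsIntegral scaled (integral-* (isometry a b) (integral-ι (+ h))))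
    where
    open ≡-Reasoning
    scaled : (qDisc G (φ a b) ℚ.- qB (suc r) a b) ℚ.* ι (+ h) ≡ ι (M a b ℤ.- + 2 ℤ.* QB a b) ℚ.* inv 4
    scaled = begin
      (qDisc G (φ a b) ℚ.- qB (suc r) a b) ℚ.* ι (+ h)
        ≡⟨ cong₂ (λ s t → (s ℚ.- t) ℚ.* ι (+ h)) (qDisc-φ a b) (/≡ι*inv (QB a b) N {{pow2-nonZero (suc r)}}) ⟩
      (ι (M a b) ℚ.* (½ ℚ.* inv N) ℚ.- ι (QB a b) ℚ.* inv N) ℚ.* ι (+ h)
        ≡⟨ regroup (ι (M a b)) (ι (QB a b)) (inv N) (ι (+ h)) ⟩
      ι (M a b) ℚ.* (½ ℚ.* (ι (+ h) ℚ.* inv N)) ℚ.- ι (QB a b) ℚ.* (ι (+ h) ℚ.* inv N)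
        ≡⟨ cong (λ s → ι (M a b) ℚ.* (½ ℚ.* s) ℚ.- ι (QB a b) ℚ.* s) ι-h*inv-N ⟩
      ι (M a b) ℚ.* (½ ℚ.* ½) ℚ.- ι (QB a b) ℚ.* (ι (+ 2) ℚ.* (½ ℚ.* ½))
        ≡⟨ factor (ι (M a b)) (ι (QB a b)) (ι (+ 2)) (½ ℚ.* ½) ⟩
      (ι (M a b) ℚ.- ι (+ 2) ℚ.* ι (QB a b)) ℚ.* inv 4
        ≡⟨ cong (ℚ._* inv 4) (sym (trans (ι-- (M a b) _) (cong (λ s → ι (M a b) ℚ.- s) (ι-* (+ 2) (QB a b))))) ⟩
      ι (M a b ℤ.- + 2 ℤ.* QB a b) ℚ.* inv 4 ∎
      where
      regroup : ∀ m q i k → (m ℚ.* (½ ℚ.* i) ℚ.- q ℚ.* i) ℚ.* k ≡ m ℚ.* (½ ℚ.* (k ℚ.* i)) ℚ.- q ℚ.* (k ℚ.* i)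
      regroup = solve-∀-in ℚ-ring
      factor : ∀ m q t f → m ℚ.* f ℚ.- q ℚ.* (t ℚ.* f) ≡ (m ℚ.- t ℚ.* q) ℚ.* f
      factor = solve-∀-in ℚ-ring

  opaque
    z : ℤVec 2
    z i = proj₁ (un∼ (φ-+ (+ 1) (+ 0) (+ 0) (+ 1)) i)

    w₃≡w₁+w₂+Nz : ∀ i → Nφ (+ 1) (+ 1) i ≡ w₁ i ℤ.+ w₂ i ℤ.+ + 2 ℤ.* + h ℤ.* z i
    w₃≡w₁+w₂+Nz i = ι-injective (begin
      ι (Nφ (+ 1) (+ 1) i)
        ≡⟨ ι-Nφ (+ 1) (+ 1) i ⟨
      ι (+ N) ℚ.* φ₁₁
        ≡⟨ split (ι (+ N)) φ₁₁ φ₁₀ φ₀₁ ⟩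
      ι (+ N) ℚ.* φ₁₀ ℚ.+ ι (+ N) ℚ.* φ₀₁ ℚ.+ ι (+ N) ℚ.* (φ₁₁ ℚ.- (φ₁₀ ℚ.+ φ₀₁))
        ≡⟨ cong₂ (λ s t → s ℚ.+ t ℚ.+ ι (+ N) ℚ.* (φ₁₁ ℚ.- (φ₁₀ ℚ.+ φ₀₁))) (ι-Nφ (+ 1) (+ 0) i) (ι-Nφ (+ 0) (+ 1) i) ⟩
      ι (w₁ i) ℚ.+ ι (w₂ i) ℚ.+ ι (+ N) ℚ.* (φ₁₁ ℚ.- (φ₁₀ ℚ.+ φ₀₁))
        ≡⟨ cong (λ s → ι (w₁ i) ℚ.+ ι (w₂ i) ℚ.+ ι (+ N) ℚ.* s) (proj₂ (un∼ (φ-+ (+ 1) (+ 0) (+ 0) (+ 1)) i)) ⟩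
      ι (w₁ i) ℚ.+ ι (w₂ i) ℚ.+ ι (+ N) ℚ.* ι (z i)
        ≡⟨ cong₂ ℚ._+_ (ι-+ (w₁ i) (w₂ i)) (trans (cong (λ n → ι (n ℤ.* z i)) (sym (ℤP.pos-* 2 h))) (ι-* (+ N) (z i))) ⟨
      ι (w₁ i ℤ.+ w₂ i) ℚ.+ ι (+ 2 ℤ.* + h ℤ.* z i)
        ≡⟨ ι-+ (w₁ i ℤ.+ w₂ i) _ ⟨
      ι (w₁ i ℤ.+ w₂ i ℤ.+ + 2 ℤ.* + h ℤ.* z i) ∎)
      where
      open ≡-Reasoning
      φ₁₁ φ₁₀ φ₀₁ : ℚ
      φ₁₁ = φ (+ 1) (+ 1) i
      φ₁₀ = φ (+ 1) (+ 0) i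
      φ₀₁ = φ (+ 0) (+ 1) i
      split : ∀ n p f₁ f₂ → n ℚ.* p ≡ n ℚ.* f₁ ℚ.+ n ℚ.* f₂ ℚ.+ n ℚ.* (p ℚ.- (f₁ ℚ.+ f₂))
      split = solve-∀-in ℚ-ring

  M₁₂ : ℤ
  M₁₂ = Bℤ U w₁ w₂

  M-mod-4 : ∀ a b → Σ ℤ λ A → M a b ≡ + 2 ℤ.* QB a b ℤ.+ A ℤ.* + 4
  M-mod-4 a b = S._∣_.quotient (M≡2QB-mod-4 a b) ,
    trans (shift (M a b) (+ 2 ℤ.* QB a b)) (cong (λ s → + 2 ℤ.* QB a b ℤ.+ s) (S._∣_.equality (M≡2QB-mod-4 a b)))
    where
    shift : ∀ m c → m ≡ c ℤ.+ (m ℤ.- c)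
    shift = ℤ-solve

  M₁₂-odd : Σ ℤ λ K → M₁₂ ≡ + 1 ℤ.+ + 2 ℤ.* K
  M₁₂-odd = K , ℤP.*-cancelˡ-≡ (+ 2) M₁₂ (+ 1 ℤ.+ + 2 ℤ.* K) (begin
    + 2 ℤ.* M₁₂
      ≡⟨ isolate (M (+ 1) (+ 0)) (M (+ 0) (+ 1)) M₁₂ E ⟩
    (M (+ 1) (+ 0) ℤ.+ + 2 ℤ.* M₁₂ ℤ.+ M (+ 0) (+ 1) ℤ.+ + 4 ℤ.* E) ℤ.- M (+ 1) (+ 0) ℤ.- M (+ 0) (+ 1) ℤ.- + 4 ℤ.* E
      ≡⟨ cong (λ s → s ℤ.- M (+ 1) (+ 0) ℤ.- M (+ 0) (+ 1) ℤ.- + 4 ℤ.* E) expansion ⟨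
    M (+ 1) (+ 1) ℤ.- M (+ 1) (+ 0) ℤ.- M (+ 0) (+ 1) ℤ.- + 4 ℤ.* E
      ≡⟨ cong₂ (λ s t → s ℤ.- t ℤ.- M (+ 0) (+ 1) ℤ.- + 4 ℤ.* E) eC eA ⟩
    (+ 6 ℤ.+ C ℤ.* + 4) ℤ.- (+ 2 ℤ.+ A ℤ.* + 4) ℤ.- M (+ 0) (+ 1) ℤ.- + 4 ℤ.* E
      ≡⟨ cong (λ s → (+ 6 ℤ.+ C ℤ.* + 4) ℤ.- (+ 2 ℤ.+ A ℤ.* + 4) ℤ.- s ℤ.- + 4 ℤ.* E) eB ⟩
    (+ 6 ℤ.+ C ℤ.* + 4) ℤ.- (+ 2 ℤ.+ A ℤ.* + 4) ℤ.- (+ 2 ℤ.+ B ℤ.* + 4) ℤ.- + 4 ℤ.* E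
      ≡⟨ collect A B C E ⟩
    + 2 ℤ.* (+ 1 ℤ.+ + 2 ℤ.* K) ∎)
    where
    open ≡-Reasoning
    A = proj₁ (M-mod-4 (+ 1) (+ 0))
    B = proj₁ (M-mod-4 (+ 0) (+ 1))
    C = proj₁ (M-mod-4 (+ 1) (+ 1))
    eA : M (+ 1) (+ 0) ≡ + 2 ℤ.+ A ℤ.* + 4
    eA = proj₂ (M-mod-4 (+ 1) (+ 0))
    eB : M (+ 0) (+ 1) ≡ + 2 ℤ.+ B ℤ.* + 4
    eB = proj₂ (M-mod-4 (+ 0) (+ 1))
    eC : M (+ 1) (+ 1) ≡ + 6 ℤ.+ C ℤ.* + 4
    eC = proj₂ (M-mod-4 (+ 1) (+ 1))
    E K : ℤ
    E = + h ℤ.* Bℤ U (λ i → w₁ i ℤ.+ w₂ i) z ℤ.+ + h ℤ.* + h ℤ.* Bℤ U z z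
    K = C ℤ.- A ℤ.- B ℤ.- E
    expansion : M (+ 1) (+ 1) ≡ M (+ 1) (+ 0) ℤ.+ + 2 ℤ.* M₁₂ ℤ.+ M (+ 0) (+ 1) ℤ.+ + 4 ℤ.* E
    expansion = trans (Bℤ-cong U w₃≡w₁+w₂+Nz w₃≡w₁+w₂+Nz) (form₂-expand u₀₀ u₀₁ u₁₁ w₁ w₂ z (+ h))
    isolate : ∀ m₁ m₂ m₁₂ e → + 2 ℤ.* m₁₂ ≡ (m₁ ℤ.+ + 2 ℤ.* m₁₂ ℤ.+ m₂ ℤ.+ + 4 ℤ.* e) ℤ.- m₁ ℤ.- m₂ ℤ.- + 4 ℤ.* e
    isolate = ℤ-solve
    collect : ∀ A B C E → (+ 6 ℤ.+ C ℤ.* + 4) ℤ.- (+ 2 ℤ.+ A ℤ.* + 4) ℤ.- (+ 2 ℤ.+ B ℤ.* + 4) ℤ.- + 4 ℤ.* E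
                          ≡ + 2 ℤ.* (+ 1 ℤ.+ + 2 ℤ.* (C ℤ.- A ℤ.- B ℤ.- E))
    collect = ℤ-solve

  DU : ℤ
  DU = u₀₀ ℤ.* u₁₁ ℤ.- u₀₁ ℤ.* u₀₁

  gram-det≡3-mod-8 : + 8 S.∣ M (+ 1) (+ 0) ℤ.* M (+ 0) (+ 1) ℤ.- M₁₂ ℤ.* M₁₂ ℤ.- + 3
  gram-det≡3-mod-8 = subst (+ 8 S.∣_) (sym (begin
    M (+ 1) (+ 0) ℤ.* M (+ 0) (+ 1) ℤ.- M₁₂ ℤ.* M₁₂ ℤ.- + 3
      ≡⟨ cong₂ (λ s t → s ℤ.- t ℤ.- + 3) (cong₂ ℤ._*_ (proj₂ (M-mod-4 (+ 1) (+ 0))) (proj₂ (M-mod-4 (+ 0) (+ 1))))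
                                          (cong₂ ℤ._*_ (proj₂ M₁₂-odd) (proj₂ M₁₂-odd)) ⟩
    (+ 2 ℤ.+ A ℤ.* + 4) ℤ.* (+ 2 ℤ.+ B ℤ.* + 4) ℤ.- (+ 1 ℤ.+ + 2 ℤ.* K) ℤ.* (+ 1 ℤ.+ + 2 ℤ.* K) ℤ.- + 3
      ≡⟨ regroup A B K ⟩
    (+ 2 ℤ.* A ℤ.* B ℤ.+ A ℤ.+ B) ℤ.* + 8 ℤ.- ((+ 1 ℤ.+ + 2 ℤ.* K) ℤ.* (+ 1 ℤ.+ + 2 ℤ.* K) ℤ.- + 1) ∎))
    (S.∣m∣n⇒∣m-n (S.divides (+ 2 ℤ.* A ℤ.* B ℤ.+ A ℤ.+ B) refl) (8∣odd²-1 K))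
    where
    open ≡-Reasoning
    A = proj₁ (M-mod-4 (+ 1) (+ 0))
    B = proj₁ (M-mod-4 (+ 0) (+ 1))
    K = proj₁ M₁₂-odd
    regroup : ∀ A B K → (+ 2 ℤ.+ A ℤ.* + 4) ℤ.* (+ 2 ℤ.+ B ℤ.* + 4) ℤ.- (+ 1 ℤ.+ + 2 ℤ.* K) ℤ.* (+ 1 ℤ.+ + 2 ℤ.* K) ℤ.- + 3
                      ≡ (+ 2 ℤ.* A ℤ.* B ℤ.+ A ℤ.+ B) ℤ.* + 8 ℤ.- ((+ 1 ℤ.+ + 2 ℤ.* K) ℤ.* (+ 1 ℤ.+ + 2 ℤ.* K) ℤ.- + 1)
    regroup = ℤ-solve

  -- The Gram determinant of w₁, w₂ is d² · DU and d² ≡ 1 (mod 8).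
  DU≡3-mod-8 : + 8 S.∣ DU ℤ.- + 3
  DU≡3-mod-8 = subst (+ 8 S.∣_) (sym (trans (peel d DU) (cong (λ e → d ℤ.* d ℤ.* DU ℤ.- + 3 ℤ.- (e ℤ.* e ℤ.- + 1) ℤ.* DU) (proj₂ k))))
    (S.∣m∣n⇒∣m-n (subst (λ g → + 8 S.∣ g ℤ.- + 3) (form₂-gram-det u₀₀ u₀₁ u₁₁ w₁ w₂) gram-det≡3-mod-8)
                 (S.∣m⇒∣m*n DU (8∣odd²-1 (proj₁ k))))
    where
    k = odd⇒1+2k d-odd
    peel : ∀ d u → u ℤ.- + 3 ≡ d ℤ.* d ℤ.* u ℤ.- + 3 ℤ.- (d ℤ.* d ℤ.- + 1) ℤ.* u
    peel = ℤ-solve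

  DU≢0 : DU ≢ + 0
  DU≢0 DU≡0 = toWitnessFalse {a? = + 8 S.∣? (+ 0 ℤ.- + 3)} tt (subst (λ u → + 8 S.∣ u ℤ.- + 3) DU≡0 DU≡3-mod-8)

  -- The adjugate columns of U, scaled by 1/(N·|DU|), are dual vectors; as D_L has exponent N
  -- this forces |DU| to divide every entry of U, hence |DU|² ∣ DU.
  |DU|≡1 : ℤ.∣ DU ∣ ≡ 1
  |DU|≡1 = ℕP.≤-antisym (ℕP.*-cancelˡ-≤ A (subst (A ℕ.* A ℕ.≤_) (sym (ℕP.*-identityʳ A)) (ℕD.∣⇒≤ A*A∣A)))
                         (ℕ.>-nonZero⁻¹ A)
    where
    A : ℕ
    A = ℤ.∣ DU ∣
    instance
      A≢0 : NonZero A
      A≢0 = ℕ.≢-nonZero (λ A≡0 → DU≢0 (ℤP.∣i∣≡0⇒i≡0 A≡0))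
      NA≢0 : NonZero (N ℕ.* A)
      NA≢0 = ℕP.m*n≢0 N A
    y : Fin 2 → ℤVec 2
    y = adjugate₂ u₀₀ u₀₁ u₁₁
    y-dual : ∀ j → InDual G (inv (N ℕ.* A) ·ᵛ ιᵛ (y j))
    y-dual j z = subst IsIntegral
      (sym (trans (Bℚ-*ˡ G (inv (N ℕ.* A)) (ιᵛ (y j)) (ιᵛ z))
        (trans (cong (inv (N ℕ.* A) ℚ.*_) (trans (Bℚ-ι G (y j) z)
          (cong ι (trans (Bℤ-scale (+ N) G≡N*U (y j) z) (cong (+ N ℤ.*_) (form₂-adjugate u₀₀ u₀₁ u₁₁ j z))))))
        (ℚP.*-comm (inv (N ℕ.* A)) _))))
      (∣⇒integral _ (N ℕ.* A) (subst (S._∣ + N ℤ.* (DU ℤ.* z j)) (sym (ℤP.pos-* N A))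
        (S.*-monoʳ-∣ (+ N) (S.∣m⇒∣m*n (z j) (S.∣m∣∣m {DU})))))
    N*inv-NA : ι (+ N) ℚ.* inv (N ℕ.* A) ≡ inv A
    N*inv-NA = ι*-cancelˡ A (trans (sym (ℚP.*-assoc (ι (+ A)) (ι (+ N)) _))
      (trans (cong (ℚ._* inv (N ℕ.* A)) (trans (sym (ι-* (+ A) (+ N))) (cong ι (trans (ℤP.*-comm (+ A) (+ N)) (sym (ℤP.pos-* N A))))))
        (trans (ι*inv (N ℕ.* A)) (sym (ι*inv A)))))
    A∣y : ∀ j i → + A S.∣ y j i
    A∣y j i = integral⇒∣ (y j i) A (subst IsIntegral
      (trans (sym (ℚP.*-assoc (ι (+ N)) (inv (N ℕ.* A)) _)) (trans (cong (ℚ._* ι (y j i)) N*inv-NA) (ℚP.*-comm (inv A) (ι (y j i)))))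
      (N·dual∈L (inv (N ℕ.* A) ·ᵛ ιᵛ (y j)) (y-dual j) i))
    A∣u₀₁ : + A S.∣ u₀₁
    A∣u₀₁ = subst (+ A S.∣_) (ℤP.neg-involutive u₀₁) (S.∣m⇒∣-m (A∣y zero (suc zero)))
    A*A∣A : (A ℕ.* A) ℕD.∣ A
    A*A∣A = subst₂ ℕD._∣_ (ℤP.abs-* (+ A) (+ A)) refl (S.∣⇒∣ᵤ (S.∣-trans
      (S.∣m∣n⇒∣m-n (S.∣-trans (S.*-monoʳ-∣ (+ A) (A∣y zero zero)) (S.*-monoˡ-∣ u₁₁ (A∣y (suc zero) (suc zero))))
                    (S.∣-trans (S.*-monoʳ-∣ (+ A) A∣u₀₁) (S.*-monoˡ-∣ u₀₁ A∣u₀₁)))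
      S.m∣∣m∣))

  contradiction : ⊥
  contradiction = ¬8∣u-3 DU |DU|≡1 DU≡3-mod-8
    where
    ¬8∣u-3 : ∀ u → ℤ.∣ u ∣ ≡ 1 → ¬ (+ 8 S.∣ u ℤ.- + 3)
    ¬8∣u-3 (+ 1)      _ = toWitnessFalse {a? = + 8 S.∣? (+ 1 ℤ.- + 3)} tt
    ¬8∣u-3 -[1+ 0 ]   _ = toWitnessFalse {a? = + 8 S.∣? (-[1+ 0 ] ℤ.- + 3)} tt
    ¬8∣u-3 (+ 0)      ()
    ¬8∣u-3 (+ suc (suc _)) ()
    ¬8∣u-3 -[1+ suc _ ]    ()

¬DiscIsoB-rank2 : ∀ r (G : Mat 2) → IsSymmetric G → ¬ DiscIsoB (suc r) G
¬DiscIsoB-rank2 = Rank2.contradiction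

-- Explicit isomorphisms

basis-diag : ∀ {n} (k : Fin n) → basis k k ≡ + 1
basis-diag zero    = refl
basis-diag (suc k) = basis-diag k

module CoordinateIso {n : ℕ} (t : ℕ) {{_ : NonZero t}} (G : Mat n) (k₁ k₂ : Fin n)
                     (k₁k₂ : basis k₁ k₂ ≡ + 0) (k₂k₁ : basis k₂ k₁ ≡ + 0) where

  gen : ℤ → ℤ → ℤVec n
  gen a b i = a ℤ.* basis k₁ i ℤ.+ b ℤ.* basis k₂ i

  φ : ℤ → ℤ → ℚVec n
  φ a b = inv t ·ᵛ ιᵛ (gen a b)

  gen-k₁ : ∀ a b → gen a b k₁ ≡ a
  gen-k₁ a b = trans (cong₂ (λ u v → a ℤ.* u ℤ.+ b ℤ.* v) (basis-diag k₁) k₂k₁) (ℤ-solve′ a b)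
    where
    ℤ-solve′ : ∀ a b → a ℤ.* + 1 ℤ.+ b ℤ.* + 0 ≡ a
    ℤ-solve′ = ℤ-solve

  gen-k₂ : ∀ a b → gen a b k₂ ≡ b
  gen-k₂ a b = trans (cong₂ (λ u v → a ℤ.* u ℤ.+ b ℤ.* v) k₁k₂ (basis-diag k₂)) (ℤ-solve′ a b)
    where
    ℤ-solve′ : ∀ a b → a ℤ.* + 0 ℤ.+ b ℤ.* + 1 ≡ b
    ℤ-solve′ = ℤ-solve

  φ-difference : ∀ a b a' b' i → (φ a b -ᵥ φ a' b') i ≡ ι (gen (a ℤ.- a') (b ℤ.- b') i) ℚ.* inv t
  φ-difference a b a' b' i = begin
    inv t ℚ.* ι (gen a b i) ℚ.- inv t ℚ.* ι (gen a' b' i)  ≡⟨ factor (inv t) (ι (gen a b i)) (ι (gen a' b' i)) ⟩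
    (ι (gen a b i) ℚ.- ι (gen a' b' i)) ℚ.* inv t          ≡⟨ cong (ℚ._* inv t) (sym (ι-- (gen a b i) (gen a' b' i))) ⟩
    ι (gen a b i ℤ.- gen a' b' i) ℚ.* inv t                ≡⟨ cong (λ g → ι g ℚ.* inv t) (linear a b a' b' (basis k₁ i) (basis k₂ i)) ⟩
    ι (gen (a ℤ.- a') (b ℤ.- b') i) ℚ.* inv t              ∎
    where
    open ≡-Reasoning
    factor : ∀ c x y → c ℚ.* x ℚ.- c ℚ.* y ≡ (x ℚ.- y) ℚ.* c
    factor = solve-∀-in ℚ-ring
    linear : ∀ a b a' b' e₁ e₂ → (a ℤ.* e₁ ℤ.+ b ℤ.* e₂) ℤ.- (a' ℤ.* e₁ ℤ.+ b' ℤ.* e₂) ≡ (a ℤ.- a') ℤ.* e₁ ℤ.+ (b ℤ.- b') ℤ.* e₂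
    linear = ℤ-solve

  φ-wd : ∀ a b a' b' → a ≡[mod t ] a' × b ≡[mod t ] b' → InL (φ a b -ᵥ φ a' b')
  φ-wd a b a' b' (t∣a-a' , t∣b-b') i = subst IsIntegral (sym (φ-difference a b a' b' i))
    (∣⇒integral (gen (a ℤ.- a') (b ℤ.- b') i) t
      (S.∣m∣n⇒∣m+n (S.∣m⇒∣m*n (basis k₁ i) (S.∣ᵤ⇒∣ {+ t} {a ℤ.- a'} t∣a-a')) (S.∣m⇒∣m*n (basis k₂ i) (S.∣ᵤ⇒∣ {+ t} {b ℤ.- b'} t∣b-b'))))

  φ-inj : ∀ a b a' b' → InL (φ a b -ᵥ φ a' b') → a ≡[mod t ] a' × b ≡[mod t ] b'
  φ-inj a b a' b' φ-φ'∈L =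
    S.∣⇒∣ᵤ (subst (+ t S.∣_) (gen-k₁ (a ℤ.- a') (b ℤ.- b')) (at k₁)) , S.∣⇒∣ᵤ (subst (+ t S.∣_) (gen-k₂ (a ℤ.- a') (b ℤ.- b')) (at k₂))
    where
    at : ∀ i → + t S.∣ gen (a ℤ.- a') (b ℤ.- b') i
    at i = integral⇒∣ (gen (a ℤ.- a') (b ℤ.- b') i) t (subst IsIntegral (φ-difference a b a' b' i) (φ-φ'∈L i))

  φ-hom : ∀ a b a' b' → InL (φ (a ℤ.+ a') (b ℤ.+ b') -ᵥ (φ a b +ᵥ φ a' b'))
  φ-hom a b a' b' i = subst IsIntegral (sym (begin
    inv t ℚ.* ι (gen (a ℤ.+ a') (b ℤ.+ b') i) ℚ.- (inv t ℚ.* ι (gen a b i) ℚ.+ inv t ℚ.* ι (gen a' b' i))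
      ≡⟨ cong (λ g → inv t ℚ.* g ℚ.- (inv t ℚ.* ι (gen a b i) ℚ.+ inv t ℚ.* ι (gen a' b' i)))
              (trans (cong ι (linear a b a' b' (basis k₁ i) (basis k₂ i))) (ι-+ (gen a b i) (gen a' b' i))) ⟩
    inv t ℚ.* (ι (gen a b i) ℚ.+ ι (gen a' b' i)) ℚ.- (inv t ℚ.* ι (gen a b i) ℚ.+ inv t ℚ.* ι (gen a' b' i))
      ≡⟨ cancel (inv t) (ι (gen a b i)) (ι (gen a' b' i)) ⟩
    ℚ.0ℚ ∎)) integral-0
    where
    open ≡-Reasoning
    linear : ∀ a b a' b' e₁ e₂ → (a ℤ.+ a') ℤ.* e₁ ℤ.+ (b ℤ.+ b') ℤ.* e₂ ≡ (a ℤ.* e₁ ℤ.+ b ℤ.* e₂) ℤ.+ (a' ℤ.* e₁ ℤ.+ b' ℤ.* e₂)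
    linear = ℤ-solve
    cancel : ∀ c x y → c ℚ.* (x ℚ.+ y) ℚ.- (c ℚ.* x ℚ.+ c ℚ.* y) ≡ ℚ.0ℚ
    cancel = solve-∀-in ℚ-ring

  inv*ι-t* : ∀ k → inv t ℚ.* ι (k ℤ.* + t) ≡ ι k
  inv*ι-t* k = begin
    inv t ℚ.* ι (k ℤ.* + t)       ≡⟨ cong (inv t ℚ.*_) (ι-* k (+ t)) ⟩
    inv t ℚ.* (ι k ℚ.* ι (+ t))   ≡⟨ swap (inv t) (ι k) (ι (+ t)) ⟩
    ι k ℚ.* (inv t ℚ.* ι (+ t))   ≡⟨ cong (ι k ℚ.*_) (inv*ι t) ⟩
    ι k ℚ.* ℚ.1ℚ                  ≡⟨ ℚP.*-identityʳ (ι k) ⟩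
    ι k                           ∎
    where
    open ≡-Reasoning
    swap : ∀ i k n → i ℚ.* (k ℚ.* n) ≡ k ℚ.* (i ℚ.* n)
    swap = solve-∀-in ℚ-ring

  φ-dual : (pairing : ℤ → ℤ → ℤVec n → ℤ) → (∀ a b w → Bℤ G (gen a b) w ≡ pairing a b w ℤ.* + t) →
           ∀ a b → InDual G (φ a b)
  φ-dual pairing B≡ a b w = pairing a b w , (begin
    Bℚ G (inv t ·ᵛ ιᵛ (gen a b)) (ιᵛ w)   ≡⟨ Bℚ-*ˡ G (inv t) (ιᵛ (gen a b)) (ιᵛ w) ⟩
    inv t ℚ.* Bℚ G (ιᵛ (gen a b)) (ιᵛ w)  ≡⟨ cong (inv t ℚ.*_) (trans (Bℚ-ι G (gen a b) w) (cong ι (B≡ a b w))) ⟩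
    inv t ℚ.* ι (pairing a b w ℤ.* + t)   ≡⟨ inv*ι-t* (pairing a b w) ⟩
    ι (pairing a b w)                     ∎)
    where open ≡-Reasoning

  φ-isometry : (Q : ℤ → ℤ → ℤ) → (∀ a b → Bℤ G (gen a b) (gen a b) ≡ Q a b ℤ.* + t ℤ.* + 2) →
               ∀ a b → IsIntegral (qDisc G (φ a b) ℚ.- Q a b ℚ./ t)
  φ-isometry Q B≡ a b = subst IsIntegral (sym (begin
    ½ ℚ.* Bℚ G (φ a b) (φ a b) ℚ.- Q a b ℚ./ t
      ≡⟨ cong₂ ℚ._-_ (cong (½ ℚ.*_) (trans (Bℚ-*ˡ G (inv t) (ιᵛ (gen a b)) (φ a b))
                                      (cong (inv t ℚ.*_) (Bℚ-*ʳ G (inv t) (ιᵛ (gen a b)) (ιᵛ (gen a b))))))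
                      (/≡ι*inv (Q a b) t) ⟩
    ½ ℚ.* (inv t ℚ.* (inv t ℚ.* Bℚ G (ιᵛ (gen a b)) (ιᵛ (gen a b)))) ℚ.- ι (Q a b) ℚ.* inv t
      ≡⟨ cong (λ s → ½ ℚ.* (inv t ℚ.* (inv t ℚ.* s)) ℚ.- ι (Q a b) ℚ.* inv t)
              (trans (Bℚ-ι G (gen a b) (gen a b)) (trans (cong ι (B≡ a b)) (ι-* (Q a b ℤ.* + t) (+ 2)))) ⟩
    ½ ℚ.* (inv t ℚ.* (inv t ℚ.* (ι (Q a b ℤ.* + t) ℚ.* ι (+ 2)))) ℚ.- ι (Q a b) ℚ.* inv t
      ≡⟨ regroup ½ (inv t) (ι (Q a b ℤ.* + t)) (ι (+ 2)) (ι (Q a b)) ⟩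
    (½ ℚ.* ι (+ 2)) ℚ.* (inv t ℚ.* (inv t ℚ.* ι (Q a b ℤ.* + t))) ℚ.- ι (Q a b) ℚ.* inv t
      ≡⟨ cong (λ s → (½ ℚ.* ι (+ 2)) ℚ.* (inv t ℚ.* s) ℚ.- ι (Q a b) ℚ.* inv t) (inv*ι-t* (Q a b)) ⟩
    ℚ.1ℚ ℚ.* (inv t ℚ.* ι (Q a b)) ℚ.- ι (Q a b) ℚ.* inv t
      ≡⟨ cancel (inv t) (ι (Q a b)) ⟩
    ℚ.0ℚ ∎)) integral-0
    where
    open ≡-Reasoning
    regroup : ∀ h i x two q → h ℚ.* (i ℚ.* (i ℚ.* (x ℚ.* two))) ℚ.- q ℚ.* i ≡ (h ℚ.* two) ℚ.* (i ℚ.* (i ℚ.* x)) ℚ.- q ℚ.* i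
    regroup = solve-∀-in ℚ-ring
    cancel : ∀ i q → ℚ.1ℚ ℚ.* (i ℚ.* q) ℚ.- q ℚ.* i ≡ ℚ.0ℚ
    cancel = solve-∀-in ℚ-ring

  divide-by-t : ∀ x k → x ℚ.* ι (+ t) ≡ ι k → x ≡ inv t ℚ.* ι k
  divide-by-t x k e = begin
    x                            ≡⟨ ℚP.*-identityʳ x ⟨
    x ℚ.* ℚ.1ℚ                   ≡⟨ cong (x ℚ.*_) (ι*inv t) ⟨
    x ℚ.* (ι (+ t) ℚ.* inv t)    ≡⟨ ℚP.*-assoc x (ι (+ t)) (inv t) ⟨
    x ℚ.* ι (+ t) ℚ.* inv t      ≡⟨ cong (ℚ._* inv t) e ⟩
    ι k ℚ.* inv t                ≡⟨ ℚP.*-comm (ι k) (inv t) ⟩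
    inv t ℚ.* ι k                ∎
    where open ≡-Reasoning

module LatticeC (r : ℕ) where
  t : ℕ
  t = pow2 r

  instance
    t≢0 : NonZero t
    t≢0 = pow2-nonZero r

  G : Mat 2
  G = GramC r

  open CoordinateIso t G zero (suc zero) refl refl

  Gᴾ : ∀ {m} → Polynomial m → Fin 2 → Fin 2 → Polynomial m
  Gᴾ T = sym₂ (con (+ 0)) T (con (+ 0))

  G-sym : IsSymmetric G
  G-sym zero       zero       = refl
  G-sym zero       (suc zero) = refl
  G-sym (suc zero) zero       = refl
  G-sym (suc zero) (suc zero) = refl

  G-even : IsEven G
  G-even x = S.∣⇒∣ᵤ (S.divides (x zero ℤ.* x (suc zero) ℤ.* + t)
    (prove (x zero ∷ x (suc zero) ∷ + t ∷ [])
      (Bᴾ (Gᴾ (var (# 2))) X X) (var (# 0) :* var (# 1) :* var (# 2) :* con (+ 2)) refl))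
    where
    X : Fin 2 → Polynomial 3
    X = vec₂ (var (# 0)) (var (# 1))

  det-G : det G ≡ ℤ.- (+ t ℤ.* + t)
  det-G = prove (+ t ∷ []) (detᴾ (Gᴾ (var (# 0)))) (:- (var (# 0) :* var (# 0))) refl

  G-nondeg : IsNondegenerate G
  G-nondeg det≡0 = ℕ.≢-nonZero⁻¹ (t ℕ.* t) {{ℕP.m*n≢0 t t}}
    (ℤP.+-injective (trans (ℤP.pos-* t t) (ℤP.neg-injective (trans (sym det-G) det≡0))))

  B-gen : ∀ a b w → Bℤ G (gen a b) w ≡ (a ℤ.* w (suc zero) ℤ.+ b ℤ.* w zero) ℤ.* + t
  B-gen a b w = prove (a ∷ b ∷ w zero ∷ w (suc zero) ∷ + t ∷ [])
    (Bᴾ (Gᴾ T) (λ i → A :* con (basis zero i) :+ B :* con (basis (suc zero) i)) (vec₂ W₀ W₁))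
    ((A :* W₁ :+ B :* W₀) :* T) refl
    where
    A = var (# 0) ; B = var (# 1) ; W₀ = var (# 2) ; W₁ = var (# 3) ; T = var (# 4)

  surjective : ∀ v → InDual G v → Σ ℤ λ a → Σ ℤ λ b → InL (v -ᵥ φ a b)
  surjective v v∈L♯ = k₁ , k₀ , λ where
      zero       → subst IsIntegral (sym (trans (cong₂ (λ x g → x ℚ.- inv t ℚ.* ι g) (divide-by-t (v zero) k₁ e₁) (gen-k₁ k₁ k₀))
                                                (ℚP.+-inverseʳ (inv t ℚ.* ι k₁)))) integral-0
      (suc zero) → subst IsIntegral (sym (trans (cong₂ (λ x g → x ℚ.- inv t ℚ.* ι g) (divide-by-t (v (suc zero)) k₀ e₀) (gen-k₂ k₁ k₀))
                                                (ℚP.+-inverseʳ (inv t ℚ.* ι k₀)))) integral-0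
    where
    k₀ k₁ : ℤ
    k₀ = proj₁ (v∈L♯ (basis zero))
    k₁ = proj₁ (v∈L♯ (basis (suc zero)))
    column : ∀ x y g → x ℚ.* ℚ.0ℚ ℚ.+ (y ℚ.* g ℚ.+ ℚ.0ℚ) ≡ y ℚ.* g
    column = solve-∀-in ℚ-ring
    column′ : ∀ x y g → x ℚ.* g ℚ.+ (y ℚ.* ℚ.0ℚ ℚ.+ ℚ.0ℚ) ≡ x ℚ.* g
    column′ = solve-∀-in ℚ-ring
    e₀ : v (suc zero) ℚ.* ι (+ t) ≡ ι k₀
    e₀ = trans (sym (trans (Bℚ-basisʳ G v zero) (column (v zero) (v (suc zero)) (ι (+ t))))) (proj₂ (v∈L♯ (basis zero)))
    e₁ : v zero ℚ.* ι (+ t) ≡ ι k₁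
    e₁ = trans (sym (trans (Bℚ-basisʳ G v (suc zero)) (column′ (v zero) (v (suc zero)) (ι (+ t))))) (proj₂ (v∈L♯ (basis (suc zero))))

  discIso : DiscIsoC r G
  discIso = record
    { φ = φ
    ; dual = φ-dual (λ a b w → a ℤ.* w (suc zero) ℤ.+ b ℤ.* w zero) B-gen
    ; wd-inj = φ-wd
    ; inj = φ-inj
    ; hom = φ-hom
    ; surj = surjective
    ; isometry = φ-isometry (λ a b → a ℤ.* b) λ a b →
        trans (B-gen a b (gen a b)) (ℤ-solve′ a b (+ t))
    }
    where
    ℤ-solve′ : ∀ a b t → (a ℤ.* (a ℤ.* + 0 ℤ.+ b ℤ.* + 1) ℤ.+ b ℤ.* (a ℤ.* + 1 ℤ.+ b ℤ.* + 0)) ℤ.* t ≡ a ℤ.* b ℤ.* t ℤ.* + 2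
    ℤ-solve′ = ℤ-solve

-- Unlike solver polynomials these have no rational constants, so they are integral at integral points.
data IntExpr (n : ℕ) : Set where
  atom    : Fin n → IntExpr n
  𝟘 𝟙     : IntExpr n
  _⊕_ _⊛_ : IntExpr n → IntExpr n → IntExpr n
  ⊝_      : IntExpr n → IntExpr n

infixl 6 _⊕_
infixl 7 _⊛_
infix  8 ⊝_

toℚPolynomial : ∀ {n} → IntExpr n → ℚPolynomial n
toℚPolynomial (atom i) = ℚSolver.+-*-Solver.var i
toℚPolynomial 𝟘        = ℚSolver.+-*-Solver.con ℚ.0ℚ
toℚPolynomial 𝟙        = ℚSolver.+-*-Solver.con ℚ.1ℚ
toℚPolynomial (a ⊕ b)  = toℚPolynomial a ℚSolver.+-*-Solver.:+ toℚPolynomial b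
toℚPolynomial (a ⊛ b)  = toℚPolynomial a ℚSolver.+-*-Solver.:* toℚPolynomial b
toℚPolynomial (⊝ a)    = ℚSolver.+-*-Solver.:- toℚPolynomial a

⟦_⟧ : ∀ {n} → IntExpr n → Vec ℚ n → ℚ
⟦ e ⟧ = ℚ⟦ toℚPolynomial e ⟧

integral-⟦⟧ : ∀ {n} (e : IntExpr n) (ρ : Vec ℚ n) → (∀ i → IsIntegral (Data.Vec.lookup ρ i)) → IsIntegral (⟦ e ⟧ ρ)
integral-⟦⟧ (atom i) ρ ρ∈ℤ = ρ∈ℤ i
integral-⟦⟧ 𝟘        ρ ρ∈ℤ = integral-0
integral-⟦⟧ 𝟙        ρ ρ∈ℤ = integral-ι (+ 1)
integral-⟦⟧ (a ⊕ b)  ρ ρ∈ℤ = integral-+ (integral-⟦⟧ a ρ ρ∈ℤ) (integral-⟦⟧ b ρ ρ∈ℤ)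
integral-⟦⟧ (a ⊛ b)  ρ ρ∈ℤ = integral-* (integral-⟦⟧ a ρ ρ∈ℤ) (integral-⟦⟧ b ρ ρ∈ℤ)
integral-⟦⟧ (⊝ a)    ρ ρ∈ℤ = integral-neg (integral-⟦⟧ a ρ ρ∈ℤ)

prove-IntExpr : ∀ {n} (ρ : Vec ℚ n) (a b : IntExpr n) →
  ℚ⟦ toℚPolynomial a ⟧↓ ρ ≡ ℚ⟦ toℚPolynomial b ⟧↓ ρ → ⟦ a ⟧ ρ ≡ ⟦ b ⟧ ρ
prove-IntExpr ρ a b = ℚ-prove ρ (toℚPolynomial a) (toℚPolynomial b)

lit : ∀ {n} → ℕ → IntExpr n
lit zero          = 𝟘
lit (suc zero)    = 𝟙
lit (suc (suc k)) = 𝟙 ⊕ lit (suc k)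

Σ̂ : ∀ {m n} → (Fin n → IntExpr m) → IntExpr m
Σ̂ {n = zero}  f = 𝟘
Σ̂ {n = suc n} f = f zero ⊕ Σ̂ (λ i → f (suc i))

vec₄ : ∀ {A : Set} → A → A → A → A → Fin 4 → A
vec₄ a b c d zero                   = a
vec₄ a b c d (suc zero)             = b
vec₄ a b c d (suc (suc zero))       = c
vec₄ a b c d (suc (suc (suc zero))) = d

integral-sumℚ : ∀ {n} (f : Fin n → ℚ) → (∀ i → IsIntegral (f i)) → IsIntegral (sumℚ f)
integral-sumℚ {zero}  f f∈ℤ = integral-0
integral-sumℚ {suc n} f f∈ℤ = integral-+ (f∈ℤ zero) (integral-sumℚ (λ i → f (suc i)) (λ i → f∈ℤ (suc i)))

weaken : ∀ {m} n → IntExpr m → IntExpr (m ℕ.+ n)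
weaken n (atom i) = atom (i ↑ˡ n)
weaken n 𝟘        = 𝟘
weaken n 𝟙        = 𝟙
weaken n (a ⊕ b)  = weaken n a ⊕ weaken n b
weaken n (a ⊛ b)  = weaken n a ⊛ weaken n b
weaken n (⊝ a)    = ⊝ weaken n a

-- Over ℤ[t, v, x, e] modulo 3x = tv² + e and e² = 1, the matrix
--   M = [[2, 1, 0, 0], [1, 2, v, 0], [0, tv, 2x, 1], [0, 0, 1, 2e]]
-- has determinant D = 1 and adjugate K.
module Unimodular where
  T V X E : ∀ {n} → IntExpr (4 ℕ.+ n)
  T = atom (# 0) ; V = atom (# 1) ; X = atom (# 2) ; E = atom (# 3)

  M-row : Fin 4 → IntExpr 8
  M-row = vec₄ (lit 2 ⊛ U₀ ⊕ U₁)
               (U₀ ⊕ lit 2 ⊛ U₁ ⊕ V ⊛ U₂)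
               (T ⊛ V ⊛ U₁ ⊕ lit 2 ⊛ X ⊛ U₂ ⊕ U₃)
               (U₂ ⊕ lit 2 ⊛ E ⊛ U₃)
    where
    U₀ U₁ U₂ U₃ : IntExpr 8
    U₀ = atom (# 4) ; U₁ = atom (# 5) ; U₂ = atom (# 6) ; U₃ = atom (# 7)

  K : Fin 4 → Fin 4 → IntExpr 4
  K = vec₄ (vec₄ (⊝ lit 2 ⊕ lit 8 ⊛ X ⊛ E ⊕ ⊝ (lit 2 ⊛ T ⊛ V ⊛ V ⊛ E)) (𝟙 ⊕ ⊝ (lit 4 ⊛ X ⊛ E)) (lit 2 ⊛ V ⊛ E) (⊝ V))
           (vec₄ (𝟙 ⊕ ⊝ (lit 4 ⊛ X ⊛ E)) (⊝ lit 2 ⊕ lit 8 ⊛ X ⊛ E) (⊝ (lit 4 ⊛ V ⊛ E)) (lit 2 ⊛ V))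
           (vec₄ (lit 2 ⊛ T ⊛ V ⊛ E) (⊝ (lit 4 ⊛ T ⊛ V ⊛ E)) (lit 6 ⊛ E) (⊝ lit 3))
           (vec₄ (⊝ (T ⊛ V)) (lit 2 ⊛ T ⊛ V) (⊝ lit 3) (lit 6 ⊛ X ⊕ ⊝ (lit 2 ⊛ T ⊛ V ⊛ V)))

  D : IntExpr 8
  D = ⊝ lit 3 ⊕ lit 12 ⊛ X ⊛ E ⊕ ⊝ (lit 4 ⊛ T ⊛ V ⊛ V ⊛ E)

  module _ (t v x e : ℚ) (u : ℚVec 4) where
    ρ₄ : Vec ℚ 4
    ρ₄ = t ∷ v ∷ x ∷ e ∷ []

    ρ : Vec ℚ 8
    ρ = t ∷ v ∷ x ∷ e ∷ u zero ∷ u (suc zero) ∷ u (suc (suc zero)) ∷ u (suc (suc (suc zero))) ∷ []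

    adjugate : ∀ i → ⟦ D ⟧ ρ ℚ.* u i ≡ sumℚ (λ j → ⟦ K i j ⟧ ρ₄ ℚ.* ⟦ M-row j ⟧ ρ)
    adjugate zero                   = prove-IntExpr ρ (D ⊛ atom (# 4)) (Σ̂ λ j → weaken 4 (K zero j) ⊛ M-row j) refl
    adjugate (suc zero)             = prove-IntExpr ρ (D ⊛ atom (# 5)) (Σ̂ λ j → weaken 4 (K (suc zero) j) ⊛ M-row j) refl
    adjugate (suc (suc zero))       = prove-IntExpr ρ (D ⊛ atom (# 6)) (Σ̂ λ j → weaken 4 (K (suc (suc zero)) j) ⊛ M-row j) refl
    adjugate (suc (suc (suc zero))) = prove-IntExpr ρ (D ⊛ atom (# 7)) (Σ̂ λ j → weaken 4 (K (suc (suc (suc zero))) j) ⊛ M-row j) refl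

    D≡1 : ⟦ lit 3 ⊛ X ⟧ ρ ≡ ⟦ T ⊛ V ⊛ V ⊕ E ⟧ ρ → ⟦ E ⊛ E ⟧ ρ ≡ ℚ.1ℚ → ⟦ D ⟧ ρ ≡ ℚ.1ℚ
    D≡1 3x≡tv²+e e²≡1 = begin
      ⟦ D ⟧ ρ
        ≡⟨ prove-IntExpr ρ D (𝟙 ⊕ lit 4 ⊛ E ⊛ (lit 3 ⊛ X ⊕ ⊝ (T ⊛ V ⊛ V ⊕ E)) ⊕ lit 4 ⊛ (E ⊛ E ⊕ ⊝ 𝟙)) refl ⟩
      ℚ.1ℚ ℚ.+ F ℚ.* e ℚ.* (⟦ lit 3 ⊛ X ⟧ ρ ℚ.- ⟦ T ⊛ V ⊛ V ⊕ E ⟧ ρ) ℚ.+ F ℚ.* (⟦ E ⊛ E ⟧ ρ ℚ.- ℚ.1ℚ)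
        ≡⟨ cong₂ (λ p q → ℚ.1ℚ ℚ.+ F ℚ.* e ℚ.* p ℚ.+ F ℚ.* q)
                 (trans (cong (ℚ._- ⟦ T ⊛ V ⊛ V ⊕ E ⟧ ρ) 3x≡tv²+e) (ℚP.+-inverseʳ (⟦ T ⊛ V ⊛ V ⊕ E ⟧ ρ)))
                 (trans (cong (ℚ._- ℚ.1ℚ) e²≡1) (ℚP.+-inverseʳ ℚ.1ℚ)) ⟩
      ℚ.1ℚ ℚ.+ F ℚ.* e ℚ.* ℚ.0ℚ ℚ.+ F ℚ.* ℚ.0ℚ
        ≡⟨ vanish F e ⟩
      ℚ.1ℚ ∎
      where
      open ≡-Reasoning
      F : ℚ
      F = ⟦ lit {8} 4 ⟧ ρ
      vanish : ∀ f e → ℚ.1ℚ ℚ.+ f ℚ.* e ℚ.* ℚ.0ℚ ℚ.+ f ℚ.* ℚ.0ℚ ≡ ℚ.1ℚ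
      vanish = solve-∀-in ℚ-ring

    unimodular⇒InL : IsIntegral t → IsIntegral v → IsIntegral x → IsIntegral e →
      ⟦ lit 3 ⊛ X ⟧ ρ ≡ ⟦ T ⊛ V ⊛ V ⊕ E ⟧ ρ → ⟦ E ⊛ E ⟧ ρ ≡ ℚ.1ℚ →
      (∀ j → IsIntegral (⟦ M-row j ⟧ ρ)) → InL u
    unimodular⇒InL t∈ℤ v∈ℤ x∈ℤ e∈ℤ h₁ h₂ Mu∈ℤ i = subst IsIntegral
      (sym (trans (sym (ℚP.*-identityˡ (u i))) (trans (cong (ℚ._* u i) (sym (D≡1 h₁ h₂))) (adjugate i))))
      (integral-sumℚ _ λ j → integral-* (integral-⟦⟧ (K i j) ρ₄ ρ₄∈ℤ) (Mu∈ℤ j))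
      where
      ρ₄∈ℤ : ∀ k → IsIntegral (Data.Vec.lookup ρ₄ k)
      ρ₄∈ℤ zero                   = t∈ℤ
      ρ₄∈ℤ (suc zero)             = v∈ℤ
      ρ₄∈ℤ (suc (suc zero))       = x∈ℤ
      ρ₄∈ℤ (suc (suc (suc zero))) = e∈ℤ

ε² : ∀ r → ε r ℤ.* ε r ≡ + 1
ε² zero    = refl
ε² (suc r) = trans (square-neg (ε r)) (ε² r)
  where
  square-neg : ∀ a → (ℤ.- + 1 ℤ.* a) ℤ.* (ℤ.- + 1 ℤ.* a) ≡ a ℤ.* a
  square-neg = ℤ-solve

module LatticeB (r : ℕ) (v x : ℤ) (3x≡tv²+ε : + 3 ℤ.* x ≡ + pow2 r ℤ.* (v ℤ.* v) ℤ.+ ε r) where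
  t : ℕ
  t = pow2 r

  instance
    t≢0 : NonZero t
    t≢0 = pow2-nonZero r

  e : ℤ
  e = ε r

  G : Mat 4
  G = GramB r v x

  open CoordinateIso t G (suc zero) zero refl refl

  Gᴾ : ∀ {m} → (T V X E : Polynomial m) → Fin 4 → Fin 4 → Polynomial m
  Gᴾ T V X E = vec₄ (vec₄ (con (+ 2) :* T) T                (con (+ 0))      (con (+ 0)))
                    (vec₄ T                 (con (+ 2) :* T) (T :* V)         (con (+ 0)))
                    (vec₄ (con (+ 0))       (T :* V)         (con (+ 2) :* X) (con (+ 1)))
                    (vec₄ (con (+ 0))       (con (+ 0))      (con (+ 1))      (E :* con (+ 2)))

  G-sym : IsSymmetric G
  G-sym zero                   zero                   = refl
  G-sym zero                   (suc zero)             = refl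
  G-sym zero                   (suc (suc zero))       = refl
  G-sym zero                   (suc (suc (suc zero))) = refl
  G-sym (suc zero)             zero                   = refl
  G-sym (suc zero)             (suc zero)             = refl
  G-sym (suc zero)             (suc (suc zero))       = refl
  G-sym (suc zero)             (suc (suc (suc zero))) = refl
  G-sym (suc (suc zero))       zero                   = refl
  G-sym (suc (suc zero))       (suc zero)             = refl
  G-sym (suc (suc zero))       (suc (suc zero))       = refl
  G-sym (suc (suc zero))       (suc (suc (suc zero))) = refl
  G-sym (suc (suc (suc zero))) zero                   = refl
  G-sym (suc (suc (suc zero))) (suc zero)             = refl
  G-sym (suc (suc (suc zero))) (suc (suc zero))       = refl
  G-sym (suc (suc (suc zero))) (suc (suc (suc zero))) = refl

  half-norm : ℤVec 4 → ℤ
  half-norm y = + t ℤ.* y₀ ℤ.* y₀ ℤ.+ + t ℤ.* y₀ ℤ.* y₁ ℤ.+ + t ℤ.* y₁ ℤ.* y₁ ℤ.+ + t ℤ.* v ℤ.* y₁ ℤ.* y₂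
                ℤ.+ x ℤ.* y₂ ℤ.* y₂ ℤ.+ y₂ ℤ.* y₃ ℤ.+ e ℤ.* y₃ ℤ.* y₃
    where
    y₀ = y zero ; y₁ = y (suc zero) ; y₂ = y (suc (suc zero)) ; y₃ = y (suc (suc (suc zero)))

  B-diag : ∀ y → Bℤ G y y ≡ half-norm y ℤ.* + 2
  B-diag y = prove (+ t ∷ v ∷ x ∷ e ∷ y zero ∷ y (suc zero) ∷ y (suc (suc zero)) ∷ y (suc (suc (suc zero))) ∷ [])
    (Bᴾ (Gᴾ T V X E) Y Y)
    ((T :* Y₀ :* Y₀ :+ T :* Y₀ :* Y₁ :+ T :* Y₁ :* Y₁ :+ T :* V :* Y₁ :* Y₂ :+ X :* Y₂ :* Y₂ :+ Y₂ :* Y₃ :+ E :* Y₃ :* Y₃) :* con (+ 2))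
    refl
    where
    T = var (# 0) ; V = var (# 1) ; X = var (# 2) ; E = var (# 3)
    Y₀ = var (# 4) ; Y₁ = var (# 5) ; Y₂ = var (# 6) ; Y₃ = var (# 7)
    Y : Fin 4 → Polynomial 8
    Y = vec₄ Y₀ Y₁ Y₂ Y₃

  G-even : IsEven G
  G-even y = S.∣⇒∣ᵤ (S.divides (half-norm y) (B-diag y))

  det-G : det G ≡ + t ℤ.* + t
  det-G = begin
    det G
      ≡⟨ prove (+ t ∷ v ∷ x ∷ e ∷ []) (detᴾ (Gᴾ T V X E))
               (T :* T :* (con (+ 4) :* E :* (con (+ 3) :* X) :- con (+ 3) :- con (+ 4) :* E :* T :* (V :* V))) refl ⟩
    + t ℤ.* + t ℤ.* (+ 4 ℤ.* e ℤ.* (+ 3 ℤ.* x) ℤ.- + 3 ℤ.- + 4 ℤ.* e ℤ.* + t ℤ.* (v ℤ.* v))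
      ≡⟨ cong (λ s → + t ℤ.* + t ℤ.* (+ 4 ℤ.* e ℤ.* s ℤ.- + 3 ℤ.- + 4 ℤ.* e ℤ.* + t ℤ.* (v ℤ.* v))) 3x≡tv²+ε ⟩
    + t ℤ.* + t ℤ.* (+ 4 ℤ.* e ℤ.* (+ t ℤ.* (v ℤ.* v) ℤ.+ e) ℤ.- + 3 ℤ.- + 4 ℤ.* e ℤ.* + t ℤ.* (v ℤ.* v))
      ≡⟨ simplify (+ t) v e ⟩
    + t ℤ.* + t ℤ.* (+ 4 ℤ.* (e ℤ.* e) ℤ.- + 3)
      ≡⟨ cong (λ s → + t ℤ.* + t ℤ.* (+ 4 ℤ.* s ℤ.- + 3)) (ε² r) ⟩
    + t ℤ.* + t ℤ.* + 1
      ≡⟨ ℤP.*-identityʳ _ ⟩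
    + t ℤ.* + t ∎
    where
    open ≡-Reasoning
    T = var (# 0) ; V = var (# 1) ; X = var (# 2) ; E = var (# 3)
    simplify : ∀ t v e → t ℤ.* t ℤ.* (+ 4 ℤ.* e ℤ.* (t ℤ.* (v ℤ.* v) ℤ.+ e) ℤ.- + 3 ℤ.- + 4 ℤ.* e ℤ.* t ℤ.* (v ℤ.* v))
                         ≡ t ℤ.* t ℤ.* (+ 4 ℤ.* (e ℤ.* e) ℤ.- + 3)
    simplify = ℤ-solve

  G-nondeg : IsNondegenerate G
  G-nondeg det≡0 = ℕ.≢-nonZero⁻¹ (t ℕ.* t) {{ℕP.m*n≢0 t t}}
    (ℤP.+-injective (trans (ℤP.pos-* t t) (trans (sym det-G) det≡0)))

  pairing : ℤ → ℤ → ℤVec 4 → ℤ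
  pairing a b w = (+ 2 ℤ.* b ℤ.+ a) ℤ.* w zero ℤ.+ (b ℤ.+ + 2 ℤ.* a) ℤ.* w (suc zero) ℤ.+ v ℤ.* a ℤ.* w (suc (suc zero))

  B-gen : ∀ a b w → Bℤ G (gen a b) w ≡ pairing a b w ℤ.* + t
  B-gen a b w = prove (+ t ∷ v ∷ x ∷ e ∷ a ∷ b ∷ w zero ∷ w (suc zero) ∷ w (suc (suc zero)) ∷ w (suc (suc (suc zero))) ∷ [])
    (Bᴾ (Gᴾ T V X E) (λ i → A :* con (basis (suc zero) i) :+ B :* con (basis zero i)) W)
    (((con (+ 2) :* B :+ A) :* W zero :+ (B :+ con (+ 2) :* A) :* W (suc zero) :+ V :* A :* W (suc (suc zero))) :* T)
    refl
    where
    T = var (# 0) ; V = var (# 1) ; X = var (# 2) ; E = var (# 3) ; A = var (# 4) ; B = var (# 5)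
    W : Fin 4 → Polynomial 10
    W = vec₄ (var (# 6)) (var (# 7)) (var (# 8)) (var (# 9))

  B-gen-gen : ∀ a b → Bℤ G (gen a b) (gen a b) ≡ (a ℤ.* a ℤ.+ a ℤ.* b ℤ.+ b ℤ.* b) ℤ.* + t ℤ.* + 2
  B-gen-gen a b = trans (B-gen a b (gen a b)) (collect a b v (+ t))
    where
    collect : ∀ a b v t → ((+ 2 ℤ.* b ℤ.+ a) ℤ.* (a ℤ.* + 0 ℤ.+ b ℤ.* + 1) ℤ.+ (b ℤ.+ + 2 ℤ.* a) ℤ.* (a ℤ.* + 1 ℤ.+ b ℤ.* + 0)
                          ℤ.+ v ℤ.* a ℤ.* (a ℤ.* + 0 ℤ.+ b ℤ.* + 0)) ℤ.* t
                          ≡ (a ℤ.* a ℤ.+ a ℤ.* b ℤ.+ b ℤ.* b) ℤ.* t ℤ.* + 2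
    collect = ℤ-solve

  tq vq xq eq : ℚ
  tq = ι (+ t) ; vq = ι v ; xq = ι x ; eq = ι e

  scaled-integral : ∀ L k → tq ℚ.* L ≡ ι (+ t ℤ.* k) → IsIntegral L
  scaled-integral L k e = k , ι*-cancelˡ t (trans e (ι-* (+ t) k))

  3xe-cancels : ∀ z → z ℤ.- + 3 ℤ.* x ℤ.* e ℤ.* z ≡ + t ℤ.* (ℤ.- (e ℤ.* (v ℤ.* v) ℤ.* z))
  3xe-cancels z = begin
    z ℤ.- + 3 ℤ.* x ℤ.* e ℤ.* z
      ≡⟨ cong (λ s → z ℤ.- s ℤ.* e ℤ.* z) 3x≡tv²+ε ⟩
    z ℤ.- (+ t ℤ.* (v ℤ.* v) ℤ.+ e) ℤ.* e ℤ.* z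
      ≡⟨ expand (+ t) v e z ⟩
    + t ℤ.* (ℤ.- (e ℤ.* (v ℤ.* v) ℤ.* z)) ℤ.+ (+ 1 ℤ.- e ℤ.* e) ℤ.* z
      ≡⟨ cong (λ s → + t ℤ.* (ℤ.- (e ℤ.* (v ℤ.* v) ℤ.* z)) ℤ.+ (+ 1 ℤ.- s) ℤ.* z) (ε² r) ⟩
    + t ℤ.* (ℤ.- (e ℤ.* (v ℤ.* v) ℤ.* z)) ℤ.+ (+ 1 ℤ.- + 1) ℤ.* z
      ≡⟨ drop (+ t ℤ.* (ℤ.- (e ℤ.* (v ℤ.* v) ℤ.* z))) z ⟩
    + t ℤ.* (ℤ.- (e ℤ.* (v ℤ.* v) ℤ.* z)) ∎
    where
    open ≡-Reasoning
    expand : ∀ t v e z → z ℤ.- (t ℤ.* (v ℤ.* v) ℤ.+ e) ℤ.* e ℤ.* z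
                         ≡ t ℤ.* (ℤ.- (e ℤ.* (v ℤ.* v) ℤ.* z)) ℤ.+ (+ 1 ℤ.- e ℤ.* e) ℤ.* z
    expand = ℤ-solve
    drop : ∀ a z → a ℤ.+ (+ 1 ℤ.- + 1) ℤ.* z ≡ a
    drop = ℤ-solve

  gen≡ : ∀ a b i → gen a b i ≡ vec₄ b a (+ 0) (+ 0) i
  gen≡ a b zero                   = solve₁ a b
    where solve₁ : ∀ a b → a ℤ.* + 0 ℤ.+ b ℤ.* + 1 ≡ b
          solve₁ = ℤ-solve
  gen≡ a b (suc zero)             = solve₂ a b
    where solve₂ : ∀ a b → a ℤ.* + 1 ℤ.+ b ℤ.* + 0 ≡ a
          solve₂ = ℤ-solve
  gen≡ a b (suc (suc zero))       = solve₃ a b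
    where solve₃ : ∀ a b → a ℤ.* + 0 ℤ.+ b ℤ.* + 0 ≡ + 0
          solve₃ = ℤ-solve
  gen≡ a b (suc (suc (suc zero))) = solve₃ a b
    where solve₃ : ∀ a b → a ℤ.* + 0 ℤ.+ b ℤ.* + 0 ≡ + 0
          solve₃ = ℤ-solve

  surjective : ∀ y → InDual G y → Σ ℤ λ a → Σ ℤ λ b → InL (y -ᵥ φ a b)
  surjective y y∈L♯ = a , b , InL-resp-∼ (∼-reflexive λ i → cong (λ g → y i ℚ.- inv t ℚ.* ι g) (gen≡ a b i)) u∈L
    where
    open ≡-Reasoning
    y₀ y₁ y₂ y₃ : ℚ
    y₀ = y zero ; y₁ = y (suc zero) ; y₂ = y (suc (suc zero)) ; y₃ = y (suc (suc (suc zero)))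
    z : Fin 4 → ℤ
    z j = proj₁ (y∈L♯ (basis j))
    column : ∀ j → sumℚ (λ i → y i ℚ.* ι (G i j)) ≡ ι (z j)
    column j = trans (sym (Bℚ-basisʳ G y j)) (proj₂ (y∈L♯ (basis j)))
    -- 3xe ≡ 1 (mod t), so 2b + a ≡ z₀ and b + 2a ≡ z₁ (mod t).
    a b : ℤ
    a = x ℤ.* e ℤ.* (+ 2 ℤ.* z (suc zero) ℤ.- z zero)
    b = x ℤ.* e ℤ.* (+ 2 ℤ.* z zero ℤ.- z (suc zero))
    u : ℚVec 4
    u = y -ᵥ (inv t ·ᵛ ιᵛ (vec₄ b a (+ 0) (+ 0)))

    column₀ : y₀ ℚ.* ((ℚ.1ℚ ℚ.+ ℚ.1ℚ) ℚ.* tq) ℚ.+ y₁ ℚ.* tq ≡ ι (z zero)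
    column₀ = trans (sym (trans (cong (λ g → y₀ ℚ.* g ℚ.+ (y₁ ℚ.* tq ℚ.+ (y₂ ℚ.* ℚ.0ℚ ℚ.+ (y₃ ℚ.* ℚ.0ℚ ℚ.+ ℚ.0ℚ))))
                                     (ι-* (+ 2) (+ t)))
                               (tidy y₀ y₁ y₂ y₃ ((ℚ.1ℚ ℚ.+ ℚ.1ℚ) ℚ.* tq) tq)))
                    (column zero)
      where
      tidy : ∀ y₀ y₁ y₂ y₃ g h → y₀ ℚ.* g ℚ.+ (y₁ ℚ.* h ℚ.+ (y₂ ℚ.* ℚ.0ℚ ℚ.+ (y₃ ℚ.* ℚ.0ℚ ℚ.+ ℚ.0ℚ))) ≡ y₀ ℚ.* g ℚ.+ y₁ ℚ.* h
      tidy = solve-∀-in ℚ-ring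

    column₁ : y₀ ℚ.* tq ℚ.+ y₁ ℚ.* ((ℚ.1ℚ ℚ.+ ℚ.1ℚ) ℚ.* tq) ℚ.+ y₂ ℚ.* (tq ℚ.* vq) ≡ ι (z (suc zero))
    column₁ = trans (sym (trans (cong₂ (λ g h → y₀ ℚ.* tq ℚ.+ (y₁ ℚ.* g ℚ.+ (y₂ ℚ.* h ℚ.+ (y₃ ℚ.* ℚ.0ℚ ℚ.+ ℚ.0ℚ))))
                                       (ι-* (+ 2) (+ t)) (ι-* (+ t) v))
                               (tidy y₀ y₁ y₂ y₃ tq ((ℚ.1ℚ ℚ.+ ℚ.1ℚ) ℚ.* tq) (tq ℚ.* vq))))
                    (column (suc zero))
      where
      tidy : ∀ y₀ y₁ y₂ y₃ f g h → y₀ ℚ.* f ℚ.+ (y₁ ℚ.* g ℚ.+ (y₂ ℚ.* h ℚ.+ (y₃ ℚ.* ℚ.0ℚ ℚ.+ ℚ.0ℚ)))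
                                   ≡ y₀ ℚ.* f ℚ.+ y₁ ℚ.* g ℚ.+ y₂ ℚ.* h
      tidy = solve-∀-in ℚ-ring

    column₂ : y₁ ℚ.* (tq ℚ.* vq) ℚ.+ y₂ ℚ.* ((ℚ.1ℚ ℚ.+ ℚ.1ℚ) ℚ.* xq) ℚ.+ y₃ ≡ ι (z (suc (suc zero)))
    column₂ = trans (sym (trans (cong₂ (λ g h → y₀ ℚ.* ℚ.0ℚ ℚ.+ (y₁ ℚ.* g ℚ.+ (y₂ ℚ.* h ℚ.+ (y₃ ℚ.* ℚ.1ℚ ℚ.+ ℚ.0ℚ))))
                                       (ι-* (+ t) v) (ι-* (+ 2) x))
                               (tidy y₀ y₁ y₂ y₃ (tq ℚ.* vq) ((ℚ.1ℚ ℚ.+ ℚ.1ℚ) ℚ.* xq))))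
                    (column (suc (suc zero)))
      where
      tidy : ∀ y₀ y₁ y₂ y₃ g h → y₀ ℚ.* ℚ.0ℚ ℚ.+ (y₁ ℚ.* g ℚ.+ (y₂ ℚ.* h ℚ.+ (y₃ ℚ.* ℚ.1ℚ ℚ.+ ℚ.0ℚ)))
                                 ≡ y₁ ℚ.* g ℚ.+ y₂ ℚ.* h ℚ.+ y₃
      tidy = solve-∀-in ℚ-ring

    column₃ : y₂ ℚ.+ y₃ ℚ.* (eq ℚ.* (ℚ.1ℚ ℚ.+ ℚ.1ℚ)) ≡ ι (z (suc (suc (suc zero))))
    column₃ = trans (sym (trans (cong (λ g → y₀ ℚ.* ℚ.0ℚ ℚ.+ (y₁ ℚ.* ℚ.0ℚ ℚ.+ (y₂ ℚ.* ℚ.1ℚ ℚ.+ (y₃ ℚ.* g ℚ.+ ℚ.0ℚ))))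
                                     (ι-* e (+ 2)))
                               (tidy y₀ y₁ y₂ y₃ (eq ℚ.* (ℚ.1ℚ ℚ.+ ℚ.1ℚ)))))
                    (column (suc (suc (suc zero))))
      where
      tidy : ∀ y₀ y₁ y₂ y₃ g → y₀ ℚ.* ℚ.0ℚ ℚ.+ (y₁ ℚ.* ℚ.0ℚ ℚ.+ (y₂ ℚ.* ℚ.1ℚ ℚ.+ (y₃ ℚ.* g ℚ.+ ℚ.0ℚ))) ≡ y₂ ℚ.+ y₃ ℚ.* g
      tidy = solve-∀-in ℚ-ring

    t*inv : tq ℚ.* inv t ≡ ℚ.1ℚ
    t*inv = ι*inv t

    row₀ : IsIntegral ((ℚ.1ℚ ℚ.+ ℚ.1ℚ) ℚ.* u zero ℚ.+ u (suc zero))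
    row₀ = scaled-integral _ (ℤ.- (e ℤ.* (v ℤ.* v) ℤ.* z zero)) (begin
      tq ℚ.* ((ℚ.1ℚ ℚ.+ ℚ.1ℚ) ℚ.* (y₀ ℚ.- inv t ℚ.* ι b) ℚ.+ (y₁ ℚ.- inv t ℚ.* ι a))
        ≡⟨ expand tq (inv t) y₀ y₁ (ι a) (ι b) ⟩
      (y₀ ℚ.* ((ℚ.1ℚ ℚ.+ ℚ.1ℚ) ℚ.* tq) ℚ.+ y₁ ℚ.* tq) ℚ.- tq ℚ.* inv t ℚ.* ((ℚ.1ℚ ℚ.+ ℚ.1ℚ) ℚ.* ι b ℚ.+ ι a)
        ≡⟨ cong₂ (λ c s → c ℚ.- s ℚ.* ((ℚ.1ℚ ℚ.+ ℚ.1ℚ) ℚ.* ι b ℚ.+ ι a)) column₀ t*inv ⟩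
      ι (z zero) ℚ.- ℚ.1ℚ ℚ.* ((ℚ.1ℚ ℚ.+ ℚ.1ℚ) ℚ.* ι b ℚ.+ ι a)
        ≡⟨ cong (λ s → ι (z zero) ℚ.- s) (trans (ℚP.*-identityˡ _) (sym (trans (ι-+ (+ 2 ℤ.* b) a) (cong (ℚ._+ ι a) (ι-* (+ 2) b))))) ⟩
      ι (z zero) ℚ.- ι (+ 2 ℤ.* b ℤ.+ a)
        ≡⟨ ι-- (z zero) _ ⟨
      ι (z zero ℤ.- (+ 2 ℤ.* b ℤ.+ a))
        ≡⟨ cong ι (trans (regroup x e (z zero) (z (suc zero))) (3xe-cancels (z zero))) ⟩
      ι (+ t ℤ.* (ℤ.- (e ℤ.* (v ℤ.* v) ℤ.* z zero))) ∎)
      where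
      expand : ∀ t i y₀ y₁ a b → t ℚ.* ((ℚ.1ℚ ℚ.+ ℚ.1ℚ) ℚ.* (y₀ ℚ.- i ℚ.* b) ℚ.+ (y₁ ℚ.- i ℚ.* a))
                                 ≡ (y₀ ℚ.* ((ℚ.1ℚ ℚ.+ ℚ.1ℚ) ℚ.* t) ℚ.+ y₁ ℚ.* t) ℚ.- t ℚ.* i ℚ.* ((ℚ.1ℚ ℚ.+ ℚ.1ℚ) ℚ.* b ℚ.+ a)
      expand = solve-∀-in ℚ-ring
      regroup : ∀ x e z₀ z₁ → z₀ ℤ.- (+ 2 ℤ.* (x ℤ.* e ℤ.* (+ 2 ℤ.* z₀ ℤ.- z₁)) ℤ.+ x ℤ.* e ℤ.* (+ 2 ℤ.* z₁ ℤ.- z₀))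
                              ≡ z₀ ℤ.- + 3 ℤ.* x ℤ.* e ℤ.* z₀
      regroup = ℤ-solve

    row₁ : IsIntegral (u zero ℚ.+ (ℚ.1ℚ ℚ.+ ℚ.1ℚ) ℚ.* u (suc zero) ℚ.+ vq ℚ.* u (suc (suc zero)))
    row₁ = scaled-integral _ (ℤ.- (e ℤ.* (v ℤ.* v) ℤ.* z (suc zero))) (begin
      tq ℚ.* ((y₀ ℚ.- inv t ℚ.* ι b) ℚ.+ (ℚ.1ℚ ℚ.+ ℚ.1ℚ) ℚ.* (y₁ ℚ.- inv t ℚ.* ι a) ℚ.+ vq ℚ.* (y₂ ℚ.- inv t ℚ.* ℚ.0ℚ))
        ≡⟨ expand tq (inv t) vq y₀ y₁ y₂ (ι a) (ι b) ⟩
      (y₀ ℚ.* tq ℚ.+ y₁ ℚ.* ((ℚ.1ℚ ℚ.+ ℚ.1ℚ) ℚ.* tq) ℚ.+ y₂ ℚ.* (tq ℚ.* vq)) ℚ.- tq ℚ.* inv t ℚ.* (ι b ℚ.+ (ℚ.1ℚ ℚ.+ ℚ.1ℚ) ℚ.* ι a)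
        ≡⟨ cong₂ (λ c s → c ℚ.- s ℚ.* (ι b ℚ.+ (ℚ.1ℚ ℚ.+ ℚ.1ℚ) ℚ.* ι a)) column₁ t*inv ⟩
      ι (z (suc zero)) ℚ.- ℚ.1ℚ ℚ.* (ι b ℚ.+ (ℚ.1ℚ ℚ.+ ℚ.1ℚ) ℚ.* ι a)
        ≡⟨ cong (λ s → ι (z (suc zero)) ℚ.- s) (trans (ℚP.*-identityˡ _) (sym (trans (ι-+ b (+ 2 ℤ.* a)) (cong (ι b ℚ.+_) (ι-* (+ 2) a))))) ⟩
      ι (z (suc zero)) ℚ.- ι (b ℤ.+ + 2 ℤ.* a)
        ≡⟨ ι-- (z (suc zero)) _ ⟨
      ι (z (suc zero) ℤ.- (b ℤ.+ + 2 ℤ.* a))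
        ≡⟨ cong ι (trans (regroup x e (z zero) (z (suc zero))) (3xe-cancels (z (suc zero)))) ⟩
      ι (+ t ℤ.* (ℤ.- (e ℤ.* (v ℤ.* v) ℤ.* z (suc zero)))) ∎)
      where
      expand : ∀ t i v y₀ y₁ y₂ a b → t ℚ.* ((y₀ ℚ.- i ℚ.* b) ℚ.+ (ℚ.1ℚ ℚ.+ ℚ.1ℚ) ℚ.* (y₁ ℚ.- i ℚ.* a) ℚ.+ v ℚ.* (y₂ ℚ.- i ℚ.* ℚ.0ℚ))
        ≡ (y₀ ℚ.* t ℚ.+ y₁ ℚ.* ((ℚ.1ℚ ℚ.+ ℚ.1ℚ) ℚ.* t) ℚ.+ y₂ ℚ.* (t ℚ.* v)) ℚ.- t ℚ.* i ℚ.* (b ℚ.+ (ℚ.1ℚ ℚ.+ ℚ.1ℚ) ℚ.* a)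
      expand = solve-∀-in ℚ-ring
      regroup : ∀ x e z₀ z₁ → z₁ ℤ.- (x ℤ.* e ℤ.* (+ 2 ℤ.* z₀ ℤ.- z₁) ℤ.+ + 2 ℤ.* (x ℤ.* e ℤ.* (+ 2 ℤ.* z₁ ℤ.- z₀)))
                              ≡ z₁ ℤ.- + 3 ℤ.* x ℤ.* e ℤ.* z₁
      regroup = ℤ-solve

    row₂ : IsIntegral (tq ℚ.* vq ℚ.* u (suc zero) ℚ.+ (ℚ.1ℚ ℚ.+ ℚ.1ℚ) ℚ.* xq ℚ.* u (suc (suc zero)) ℚ.+ u (suc (suc (suc zero))))
    row₂ = subst IsIntegral (sym (begin
      tq ℚ.* vq ℚ.* (y₁ ℚ.- inv t ℚ.* ι a) ℚ.+ (ℚ.1ℚ ℚ.+ ℚ.1ℚ) ℚ.* xq ℚ.* (y₂ ℚ.- inv t ℚ.* ℚ.0ℚ) ℚ.+ (y₃ ℚ.- inv t ℚ.* ℚ.0ℚ)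
        ≡⟨ expand tq (inv t) vq xq y₁ y₂ y₃ (ι a) ⟩
      (y₁ ℚ.* (tq ℚ.* vq) ℚ.+ y₂ ℚ.* ((ℚ.1ℚ ℚ.+ ℚ.1ℚ) ℚ.* xq) ℚ.+ y₃) ℚ.- tq ℚ.* inv t ℚ.* (vq ℚ.* ι a)
        ≡⟨ cong₂ (λ c s → c ℚ.- s ℚ.* (vq ℚ.* ι a)) column₂ t*inv ⟩
      ι (z (suc (suc zero))) ℚ.- ℚ.1ℚ ℚ.* (vq ℚ.* ι a) ∎))
      (integral-- (integral-ι (z (suc (suc zero)))) (integral-* (integral-ι (+ 1)) (integral-* (integral-ι v) (integral-ι a))))
      where
      expand : ∀ t i v x y₁ y₂ y₃ a → t ℚ.* v ℚ.* (y₁ ℚ.- i ℚ.* a) ℚ.+ (ℚ.1ℚ ℚ.+ ℚ.1ℚ) ℚ.* x ℚ.* (y₂ ℚ.- i ℚ.* ℚ.0ℚ) ℚ.+ (y₃ ℚ.- i ℚ.* ℚ.0ℚ)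
        ≡ (y₁ ℚ.* (t ℚ.* v) ℚ.+ y₂ ℚ.* ((ℚ.1ℚ ℚ.+ ℚ.1ℚ) ℚ.* x) ℚ.+ y₃) ℚ.- t ℚ.* i ℚ.* (v ℚ.* a)
      expand = solve-∀-in ℚ-ring

    row₃ : IsIntegral (u (suc (suc zero)) ℚ.+ (ℚ.1ℚ ℚ.+ ℚ.1ℚ) ℚ.* eq ℚ.* u (suc (suc (suc zero))))
    row₃ = subst IsIntegral (sym (trans (expand (inv t) eq y₂ y₃) column₃)) (integral-ι (z (suc (suc (suc zero)))))
      where
      expand : ∀ i e y₂ y₃ → (y₂ ℚ.- i ℚ.* ℚ.0ℚ) ℚ.+ (ℚ.1ℚ ℚ.+ ℚ.1ℚ) ℚ.* e ℚ.* (y₃ ℚ.- i ℚ.* ℚ.0ℚ)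
                             ≡ y₂ ℚ.+ y₃ ℚ.* (e ℚ.* (ℚ.1ℚ ℚ.+ ℚ.1ℚ))
      expand = solve-∀-in ℚ-ring

    u∈L : InL u
    u∈L = Unimodular.unimodular⇒InL tq vq xq eq u (integral-ι (+ t)) (integral-ι v) (integral-ι x) (integral-ι e)
      (trans (sym (ι-* (+ 3) x)) (trans (cong ι 3x≡tv²+ε)
        (trans (ι-+ (+ t ℤ.* (v ℤ.* v)) e) (cong (ℚ._+ eq) (trans (ι-* (+ t) (v ℤ.* v))
          (trans (cong (tq ℚ.*_) (ι-* v v)) (sym (ℚP.*-assoc tq vq vq))))))))
      (trans (sym (ι-* e e)) (cong ι (ε² r)))
      λ where
        zero                   → row₀
        (suc zero)             → row₁
        (suc (suc zero))       → row₂
        (suc (suc (suc zero))) → row₃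

  discIso : DiscIsoB r G
  discIso = record
    { φ        = φ
    ; dual     = φ-dual pairing B-gen
    ; wd-inj   = φ-wd
    ; inj      = φ-inj
    ; hom      = φ-hom
    ; surj     = surjective
    ; isometry = φ-isometry (λ a b → a ℤ.* a ℤ.+ a ℤ.* b ℤ.+ b ℤ.* b) B-gen-gen
    }

rank-bound-B : ∀ r n (G : Mat n) → IsEvenNondegLattice G → DiscIsoB (suc r) G → 4 ≤ n
rank-bound-B r zero                   G _ D = ⊥-elim (¬DiscIso-rank0 (pow2 r) {{pow2-nonZero r}} G D)
rank-bound-B r (suc zero)             G _ D = ⊥-elim (¬DiscIso-rank1 (pow2 r) {{pow2-nonZero r}} G D)
rank-bound-B r (suc (suc zero))       G (G-sym , _ , _) D = ⊥-elim (¬DiscIsoB-rank2 r G G-sym D)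
rank-bound-B r (suc (suc (suc zero))) G (G-sym , G-even , _) D =
  ⊥-elim (¬DiscIso-rank3 (pow2 r) {{pow2-nonZero r}} G G-sym G-even D)
rank-bound-B r (suc (suc (suc (suc n)))) G _ D = s≤s (s≤s (s≤s (s≤s z≤n)))

rank-bound-C : ∀ r n (G : Mat n) → IsEvenNondegLattice G → DiscIsoC (suc r) G → 2 ≤ n
rank-bound-C r zero             G _ D = ⊥-elim (¬DiscIso-rank0 (pow2 r) {{pow2-nonZero r}} G D)
rank-bound-C r (suc zero)       G _ D = ⊥-elim (¬DiscIso-rank1 (pow2 r) {{pow2-nonZero r}} G D)
rank-bound-C r (suc (suc n))    G _ D = s≤s (s≤s z≤n)

theorem4p7 : (r : ℕ) → 1 ≤ r →
    ((∀ (v x : ℤ) → (+ 3) ∣ ((+ pow2 r) * (v * v) + ε r) → (+ 3) * x ≡ (+ pow2 r) * (v * v) + ε r →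
        IsEvenNondegLattice (GramB r v x) × DiscIsoB r (GramB r v x))
      × (∀ (n : ℕ) (G : Mat n) → IsEvenNondegLattice G → DiscIsoB r G → 4 ≤ n))
    × ((IsEvenNondegLattice (GramC r) × DiscIsoC r (GramC r))
      × (∀ (n : ℕ) (G : Mat n) → IsEvenNondegLattice G → DiscIsoC r G → 2 ≤ n))
theorem4p7 (suc r) (s≤s z≤n) =
  ( (λ v x _ 3x≡tv²+ε → let open LatticeB (suc r) v x 3x≡tv²+ε in (G-sym , G-even , G-nondeg) , discIso)
  , rank-bound-B r)
  , ( (let open LatticeC (suc r) in (G-sym , G-even , G-nondeg) , discIso)
    , rank-bound-C r)
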